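{- Let $s>1$ and let $\mathcal{H}_s$ be the family of $s$-node graphlets with designated incidence orbits, and let $\mathbf{U}_s$ be the matrix indexed by $\mathcal{H}_s\times\mathcal{H}_s$ with $\mathbf{U}_s(i,j)=g(H_i\mid H_j)(v)$, where $v$ is any vertex in the designated orbit of $H_j$. Then: (a) for any source graph $G=(V,E)$ and any vertex $v\in V$, $$\mathbf{U}_s\, f(\mathcal{H}_s\mid G)(v) = g(\mathcal{H}_s\mid G)(v);$$ (b) the matrix $\mathbf{U}_s\Lambda_s$ is involutory, i.e. $$\mathbf{U}_s^{ -1}=\Lambda_s\,\mathbf{U}_s\,\Lambda_s,$$ where $\Lambda_s=\mathrm{diag}(\lambda_i)$ with $\lambda_i=(-1)^{m(H_i)}$ for $H_i\in\mathcal{H}_s$, and $m(H_i)$ denotes the number of edges of $H_i$.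
   Context: All graphs are finite, undirected, simple (no multi-edges, no self-loops). A source graph $G=(V,E)$ has labeled vertices. For a connected graph $H$, the automorphism group of $H$ partitions $V(H)$ into orbits. A graphlet $H_\sigma$ is a connected graph $H$ (up to isomorphism) together with one designated orbit $\sigma$ of $V(H)$; $\mathcal{H}_s$ is the (finite) set of all graphlets $H_\sigma$ with $|V(H)|=s$, taken up to isomorphism (two graphlets are identified if there is an isomorphism of the graphs mapping the designated orbit to the designated orbit). For a graph $G$, a vertex $v\in V(G)$ and a graphlet $H_\sigma$: the gross count $g(H_\sigma\mid G)(v)$ is the number of subgraphs $H'$ of $G$ (distinct subgraphs, i.e. distinct pairs (vertex set, edge set)) such that $H'\cong H$ via an isomorphism mapping $\sigma$ to the orbit of $H'$ containing $v$ (equivalently, $v$ lies in the orbit of $H'$ corresponding to $\sigma$). The net count $f(H_\sigma\mid G)(v)$ is the number of such subgraphs $H'$ that are moreover induced subgraphs of $G$ (i.e. $E(H')=E(G)\cap (V(H')\times V(H'))$). The vectors $f(\mathcal{H}_s\mid G)(v)$ and $g(\mathcal{H}_s\mid G)(v)$ are indexed by $\mathcal{H}_s$ (in the same order as the rows/columns of $\mathbf{U}_s$) with entries $f(H_i\mid G)(v)$ and $g(H_i\mid G)(v)$ respectively. In $g(H_i\mid H_j)(v)$, $H_j$ is regarded as a source graph. -}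

module Defs where

open import Data.Nat using (ℕ; zero; suc) renaming (_+_ to _+ℕ_; _*_ to _*ℕ_)
open import Data.Integer using (ℤ; +_; -_; 1ℤ; 0ℤ) renaming (_+_ to _+ℤ_; _*_ to _*ℤ_)
open import Data.Bool using (Bool; true; false)
open import Data.Bool.Properties using () renaming (_≟_ to _≟B_)
open import Data.Fin using (Fin; zero; suc; _<_; _<?_) renaming (_≟_ to _≟F_)
open import Data.Fin.Properties using (any?; all?)
open import Data.Vec using (Vec; []; _∷_; lookup)
open import Data.List using (List; []; _∷_; length; filter; map; concatMap; cartesianProduct; allFin)
open import Data.Product using (Σ; ∃; _×_; _,_)
open import Relation.Nullary using (Dec; yes; no; ¬_)
open import Relation.Nullary.Decidable using (_×-dec_; _→-dec_)
open import Relation.Unary using (Pred; Decidable)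
open import Relation.Binary.PropositionalEquality using (_≡_; refl)
open import Function.Bundles using (_↔_; Inverse)
import Agda.Primitive

record Graph (n : ℕ) : Set where
  field
    adj   : Fin n → Fin n → Bool
    sym   : ∀ x y → adj x y ≡ adj y x
    irrfl : ∀ x → adj x x ≡ false
open Graph public

data Reachable {n : ℕ} (H : Graph n) : Fin n → Fin n → Set where
  here : ∀ {x} → Reachable H x x
  step : ∀ {x y z} → adj H x y ≡ true → Reachable H y z → Reachable H x z

Connected : ∀ {n} → Graph n → Set
Connected H = ∀ x y → Reachable H x y

-- Rooted graphs on Fin s.  A graphlet H_σ is represented by (H , r)
-- with r a vertex of the designated orbit σ.

record Rooted (s : ℕ) : Set where
  constructor _,root_
  field
    graph : Graph s
    root  : Fin s
open Rooted public

RootedIso : ∀ {s} → Rooted s → Rooted s → Set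
RootedIso {s} A B =
  Σ (Fin s ↔ Fin s) λ φ →
    (Inverse.to φ (root A) ≡ root B) ×
    (∀ x y → adj (graph A) x y ≡ adj (graph B) (Inverse.to φ x) (Inverse.to φ y))

record GraphletFamily (s k : ℕ) : Set where
  field
    rep       : Fin k → Rooted s
    connected : ∀ i → Connected (graph (rep i))
    complete  : ∀ (A : Rooted s) → Connected (graph A) → ∃ λ i → RootedIso (rep i) A
    distinct  : ∀ i j → RootedIso (rep i) (rep j) → i ≡ j
open GraphletFamily public

allVecs : ∀ {A : Set} → List A → (k : ℕ) → List (Vec A k)
allVecs xs zero    = [] ∷ []
allVecs xs (suc k) = concatMap (λ x → map (x ∷_) (allVecs xs k)) xs

count : ∀ {A : Set} {P : Pred A Agda.Primitive.lzero} → Decidable P → List A → ℕ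
count P? xs = length (filter P? xs)

∃Vec? : ∀ {n} s (P : Vec (Fin n) s → Set) → (∀ v → Dec (P v)) → Dec (∃ P)
∃Vec? zero P P? with P? []
... | yes p = yes ([] , p)
... | no ¬p = no λ { ([] , p) → ¬p p }
∃Vec? (suc s) P P? with any? (λ x → ∃Vec? s (λ w → P (x ∷ w)) (λ w → P? (x ∷ w)))
... | yes (x , w , p) = yes (x ∷ w , p)
... | no ¬q = no λ { (x ∷ w , p) → ¬q (x , w , p) }

-- Candidate subgraphs of a graph on Fin n: a vertex set (characteristic
-- vector) and an edge set (symmetric characteristic matrix).
-- Distinct candidates = distinct (vertex set, edge set) pairs.

Cand : ℕ → Set
Cand n = Vec Bool n × Vec (Vec Bool n) n

allCands : ∀ n → List (Cand n)
allCands n = cartesianProduct (allVecs bools n) (allVecs (allVecs bools n) n)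
  where
  bools : List Bool
  bools = false ∷ true ∷ []

inV : ∀ {n} → Cand n → Fin n → Bool
inV (vs , es) x = lookup vs x

inE : ∀ {n} → Cand n → Fin n → Fin n → Bool
inE (vs , es) x y = lookup (lookup es x) y

IsSubgraph : ∀ {n} → Graph n → Cand n → Set
IsSubgraph G c =
  (∀ x y → inE c x y ≡ inE c y x) ×
  (∀ x y → inE c x y ≡ true → (adj G x y ≡ true × inV c x ≡ true × inV c y ≡ true))

IsInduced : ∀ {n} → Graph n → Cand n → Set
IsInduced G c = ∀ x y → inV c x ≡ true → inV c y ≡ true → inE c x y ≡ adj G x y

IsoOnto : ∀ {s n} → Rooted s → Fin n → Cand n → Vec (Fin n) s → Set
IsoOnto {s} {n} (H ,root r) v c φ =
  (lookup φ r ≡ v) ×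
  (∀ x y → lookup φ x ≡ lookup φ y → x ≡ y) ×
  (∀ x → inV c (lookup φ x) ≡ true) ×
  (∀ u → inV c u ≡ true → ∃ λ x → lookup φ x ≡ u) ×
  (∀ x y → adj H x y ≡ inE c (lookup φ x) (lookup φ y))

-- v lies in the designated orbit of a copy c of H_σ
Copy : ∀ {s n} → Rooted s → Fin n → Cand n → Set
Copy {s} {n} A v c = ∃ λ (φ : Vec (Fin n) s) → IsoOnto A v c φ

isSubgraph? : ∀ {n} (G : Graph n) c → Dec (IsSubgraph G c)
isSubgraph? G c =
  all? (λ x → all? (λ y → inE c x y ≟B inE c y x)) ×-dec
  all? (λ x → all? (λ y → (inE c x y ≟B true) →-dec
     ((adj G x y ≟B true) ×-dec (inV c x ≟B true) ×-dec (inV c y ≟B true))))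

isInduced? : ∀ {n} (G : Graph n) c → Dec (IsInduced G c)
isInduced? G c = all? (λ x → all? (λ y → (inV c x ≟B true) →-dec (inV c y ≟B true) →-dec
  (inE c x y ≟B adj G x y)))

isoOnto? : ∀ {s n} A v c (φ : Vec (Fin n) s) → Dec (IsoOnto {s} {n} A v c φ)
isoOnto? (H ,root r) v c φ =
  (lookup φ r ≟F v) ×-dec
  all? (λ x → all? (λ y → (lookup φ x ≟F lookup φ y) →-dec (x ≟F y))) ×-dec
  all? (λ x → inV c (lookup φ x) ≟B true) ×-dec
  all? (λ u → (inV c u ≟B true) →-dec any? (λ x → lookup φ x ≟F u)) ×-dec
  all? (λ x → all? (λ y → adj H x y ≟B inE c (lookup φ x) (lookup φ y)))

copy? : ∀ {s n} A v c → Dec (Copy {s} {n} A v c)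
copy? {s} A v c = ∃Vec? s (IsoOnto A v c) (isoOnto? A v c)

gross : ∀ {s n} → Rooted s → Graph n → Fin n → ℕ
gross {s} {n} A G v =
  count (λ c → isSubgraph? G c ×-dec copy? A v c) (allCands n)

net : ∀ {s n} → Rooted s → Graph n → Fin n → ℕ
net {s} {n} A G v =
  count (λ c → (isSubgraph? G c ×-dec isInduced? G c) ×-dec copy? A v c) (allCands n)

edges : ∀ {s} → Graph s → ℕ
edges {s} H = count (λ { (x , y) → (x <? y) ×-dec (adj H x y ≟B true) })
                    (cartesianProduct (allFin s) (allFin s))

sumℕ : ∀ {k} → (Fin k → ℕ) → ℕ
sumℕ {zero}  f = 0
sumℕ {suc k} f = f zero +ℕ sumℕ (λ i → f (suc i))

sumℤ : ∀ {k} → (Fin k → ℤ) → ℤ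
sumℤ {zero}  f = 0ℤ
sumℤ {suc k} f = f zero +ℤ sumℤ (λ i → f (suc i))

sign : ℕ → ℤ
sign zero    = 1ℤ
sign (suc m) = - sign m

δ : ∀ {k} → Fin k → Fin k → ℤ
δ i j with i ≟F j
... | yes _ = 1ℤ
... | no  _ = 0ℤ

_⊗_ : ∀ {k} → (Fin k → Fin k → ℤ) → (Fin k → Fin k → ℤ) → (Fin k → Fin k → ℤ)
(M ⊗ N) i j = sumℤ (λ l → M i l *ℤ N l j)

U : ∀ {s k} → GraphletFamily s k → Fin k → Fin k → ℕ
U F i j = gross (rep F i) (graph (rep F j)) (root (rep F j))

Uℤ : ∀ {s k} → GraphletFamily s k → Fin k → Fin k → ℤ
Uℤ F i j = + U F i j

Λ : ∀ {s k} → GraphletFamily s k → Fin k → Fin k → ℤ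
Λ F i j = sign (edges (graph (rep F i))) *ℤ δ i j

-- Group the copies of H_i in G by their vertex set S: they are exactly the spanning copies of H_i in the
-- induced subgraph G[S], so there are U(i,j) of them when G[S] is a copy of H_j (such a j is unique, and
-- exists as soon as one connected copy spans S), and (a) follows.
-- For (b), expand g(H_l | G)(v) over the subgraphs d of G: a copy d of H_l has sign λ_l = (-1)^|E(d)| and
-- contains U(i,l) spanning copies of H_i, so Σ_l U(i,l) λ_l g(H_l | G)(v) sums (-1)^|E(d)| over pairs c ⊆ d
-- with c a copy of H_i and d a spanning supergraph of c in G. Toggling an edge of G missing from c pairs
-- off these d with opposite signs unless c is induced, which leaves λ_i f(H_i | G)(v). For G = H_j, where
-- f(H_i | H_j) = δ_ij and g(H_l | H_j) = U(l,j), this reads U Λ U = Λ, and Λ² = 1 gives both identities.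

module Submission where

open import Defs renaming (sym to adj-sym)
open import Data.Nat as ℕ using (ℕ; zero; suc; _<_)
import Data.Nat.Properties as ℕ
open import Data.Integer as ℤ using (ℤ; +_; -_; 1ℤ; 0ℤ; _+_; _*_)
import Data.Integer.Properties as ℤ
open import Data.Integer.Tactic.RingSolver using (solve-∀)
open import Data.Bool using (Bool; true; false; not; _∧_; _∨_; _xor_)
open import Data.Bool.Properties using (∨-comm; ∧-comm; xor-assoc; xor-same; ¬-not) renaming (_≟_ to _≟B_)
open import Data.Fin using (Fin; zero; suc; punchOut; _<?_) renaming (_≟_ to _≟F_; _<_ to _<ᶠ_)
open import Data.Fin.Properties
  using (any?; all?; punchOut-injective; injective⇒≤; suc-injective; <-cmp; <-asym; <-irrefl)
open import Data.List using (List; []; _∷_; _++_; map; concatMap; cartesianProduct; allFin; tabulate)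
open import Data.Vec using (Vec; []; _∷_; lookup) renaming (tabulate to vtabulate)
import Data.Vec.Properties as Vec
import Data.Product.Properties as Product
open import Data.Product using (∃; _×_; _,_; proj₁; proj₂)
open import Data.Sum using (_⊎_; inj₁; inj₂)
open import Data.Empty using (⊥-elim)
open import Relation.Nullary using (Dec; yes; no; ¬_; does)
open import Relation.Nullary.Decidable using (_×-dec_; _→-dec_)
open import Relation.Binary.PropositionalEquality
open import Relation.Binary.Definitions using (DecidableEquality; tri<; tri≈; tri>)
open import Function.Bundles using (Inverse; mk↔ₛ′)

𝟙 : {P : Set} → Dec P → ℤ
𝟙 (yes _) = 1ℤ
𝟙 (no _)  = 0ℤ

module _ {P : Set} where

  𝟙-yes : (p : Dec P) → P → 𝟙 p ≡ 1ℤ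
  𝟙-yes (yes _) _  = refl
  𝟙-yes (no ¬p) p = ⊥-elim (¬p p)

  𝟙-no : (p : Dec P) → ¬ P → 𝟙 p ≡ 0ℤ
  𝟙-no (yes p) ¬p = ⊥-elim (¬p p)
  𝟙-no (no _)  _  = refl

  𝟙-*-cong : (p : Dec P) {a b : ℤ} → (P → a ≡ b) → 𝟙 p * a ≡ 𝟙 p * b
  𝟙-*-cong (yes p) a≡b = cong (1ℤ *_) (a≡b p)
  𝟙-*-cong (no _)  _   = refl

module _ {P Q : Set} where

  𝟙-cong : (P → Q) → (Q → P) → (p : Dec P) (q : Dec Q) → 𝟙 p ≡ 𝟙 q
  𝟙-cong P→Q Q→P (yes _) (yes _) = refl
  𝟙-cong P→Q Q→P (no _)  (no _)  = refl
  𝟙-cong P→Q Q→P (yes p) (no ¬q) = ⊥-elim (¬q (P→Q p))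
  𝟙-cong P→Q Q→P (no ¬p) (yes q) = ⊥-elim (¬p (Q→P q))

  𝟙-× : (p : Dec P) (q : Dec Q) → 𝟙 (p ×-dec q) ≡ 𝟙 p * 𝟙 q
  𝟙-× (yes _) (yes _) = refl
  𝟙-× (yes _) (no _)  = refl
  𝟙-× (no _)  _       = refl

𝟙-split : {P : Set} (p : Dec P) (b : Bool) → 𝟙 p ≡ 𝟙 (p ×-dec (b ≟B true)) + 𝟙 (p ×-dec (b ≟B false))
𝟙-split (yes _) true  = refl
𝟙-split (yes _) false = refl
𝟙-split (no _)  true  = refl
𝟙-split (no _)  false = refl

∑ : {A : Set} → List A → (A → ℤ) → ℤ
∑ []       w = 0ℤ
∑ (a ∷ xs) w = w a + ∑ xs w

module _ {A : Set} where

  ∑-cong : (xs : List A) {w w′ : A → ℤ} → (∀ a → w a ≡ w′ a) → ∑ xs w ≡ ∑ xs w′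
  ∑-cong []       w≡w′ = refl
  ∑-cong (a ∷ xs) w≡w′ = cong₂ _+_ (w≡w′ a) (∑-cong xs w≡w′)

  ∑-zero : (xs : List A) (w : A → ℤ) → (∀ a → w a ≡ 0ℤ) → ∑ xs w ≡ 0ℤ
  ∑-zero []       w w≡0 = refl
  ∑-zero (a ∷ xs) w w≡0 rewrite w≡0 a | ∑-zero xs w w≡0 = refl

  ∑-+ : (xs : List A) (w w′ : A → ℤ) → ∑ xs (λ a → w a + w′ a) ≡ ∑ xs w + ∑ xs w′
  ∑-+ []       w w′ = refl
  ∑-+ (a ∷ xs) w w′ rewrite ∑-+ xs w w′ = interchange (w a) (w′ a) (∑ xs w) (∑ xs w′)
    where
    interchange : ∀ a b c d → a + b + (c + d) ≡ a + c + (b + d)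
    interchange = solve-∀

  ∑-*ˡ : (xs : List A) (c : ℤ) (w : A → ℤ) → ∑ xs (λ a → c * w a) ≡ c * ∑ xs w
  ∑-*ˡ []       c w = sym (ℤ.*-zeroʳ c)
  ∑-*ˡ (a ∷ xs) c w rewrite ∑-*ˡ xs c w = sym (ℤ.*-distribˡ-+ c (w a) (∑ xs w))

  ∑-++ : (xs ys : List A) (w : A → ℤ) → ∑ (xs ++ ys) w ≡ ∑ xs w + ∑ ys w
  ∑-++ []       ys w = sym (ℤ.+-identityˡ _)
  ∑-++ (a ∷ xs) ys w rewrite ∑-++ xs ys w = sym (ℤ.+-assoc (w a) _ _)

  ∑-count : {P : A → Set} (P? : ∀ a → Dec (P a)) (xs : List A) → + count P? xs ≡ ∑ xs (λ a → 𝟙 (P? a))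
  ∑-count P? []       = refl
  ∑-count P? (a ∷ xs) with P? a
  ... | yes _ = trans (ℤ.pos-+ 1 (count P? xs)) (cong (λ z → 1ℤ + z) (∑-count P? xs))
  ... | no _  = trans (∑-count P? xs) (sym (ℤ.+-identityˡ _))

  ∑-tabulate : ∀ {k} (f : Fin k → A) (w : A → ℤ) → ∑ (tabulate f) w ≡ sumℤ (λ i → w (f i))
  ∑-tabulate {zero}  f w = refl
  ∑-tabulate {suc k} f w = cong (λ z → w (f zero) + z) (∑-tabulate (λ i → f (suc i)) w)

∑-map : {A B : Set} (f : A → B) (xs : List A) (w : B → ℤ) → ∑ (map f xs) w ≡ ∑ xs (λ a → w (f a))
∑-map f []       w = refl
∑-map f (a ∷ xs) w = cong (λ z → w (f a) + z) (∑-map f xs w)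

module _ {A B : Set} where

  ∑-swap : (xs : List A) (ys : List B) (w : A → B → ℤ) →
           ∑ xs (λ a → ∑ ys (w a)) ≡ ∑ ys (λ b → ∑ xs (λ a → w a b))
  ∑-swap []       ys w = sym (∑-zero ys _ (λ _ → refl))
  ∑-swap (a ∷ xs) ys w rewrite ∑-swap xs ys w = sym (∑-+ ys (w a) (λ b → ∑ xs (λ a′ → w a′ b)))

  ∑-cartesianProduct : (xs : List A) (ys : List B) (w : A × B → ℤ) →
                       ∑ (cartesianProduct xs ys) w ≡ ∑ xs (λ a → ∑ ys (λ b → w (a , b)))
  ∑-cartesianProduct []       ys w = refl
  ∑-cartesianProduct (a ∷ xs) ys w = trans (∑-++ (map (a ,_) ys) (cartesianProduct xs ys) w)
    (cong₂ _+_ (∑-map (a ,_) ys w) (∑-cartesianProduct xs ys w))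

  ∑-concatMap : (f : A → List B) (xs : List A) (w : B → ℤ) →
                ∑ (concatMap f xs) w ≡ ∑ xs (λ a → ∑ (f a) w)
  ∑-concatMap f []       w = refl
  ∑-concatMap f (a ∷ xs) w =
    trans (∑-++ (f a) (concatMap f xs) w) (cong (λ z → ∑ (f a) w + z) (∑-concatMap f xs w))

sumℤ≡∑allFin : ∀ {k} (w : Fin k → ℤ) → sumℤ w ≡ ∑ (allFin k) w
sumℤ≡∑allFin w = sym (∑-tabulate (λ i → i) w)

sumℤ-cong : ∀ {k} {f g : Fin k → ℤ} → (∀ i → f i ≡ g i) → sumℤ f ≡ sumℤ g
sumℤ-cong {k} {f} {g} f≡g =
  trans (sumℤ≡∑allFin f) (trans (∑-cong (allFin k) f≡g) (sym (sumℤ≡∑allFin g)))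

sumℤ-zero : ∀ {k} (f : Fin k → ℤ) → (∀ i → f i ≡ 0ℤ) → sumℤ f ≡ 0ℤ
sumℤ-zero {k} f f≡0 = trans (sumℤ≡∑allFin f) (∑-zero (allFin k) f f≡0)

sumℤ-*ˡ : ∀ {k} (c : ℤ) (f : Fin k → ℤ) → sumℤ (λ l → c * f l) ≡ c * sumℤ f
sumℤ-*ˡ {k} c f =
  trans (sumℤ≡∑allFin (λ l → c * f l)) (trans (∑-*ˡ (allFin k) c f) (cong (c *_) (sym (sumℤ≡∑allFin f))))

∑-sumℤ : ∀ {A : Set} {k} (xs : List A) (w : A → Fin k → ℤ) →
         ∑ xs (λ a → sumℤ (w a)) ≡ sumℤ (λ l → ∑ xs (λ a → w a l))
∑-sumℤ {k = k} xs w = trans (∑-cong xs (λ a → sumℤ≡∑allFin (w a)))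
  (trans (∑-swap xs (allFin k) w) (sym (sumℤ≡∑allFin {k} (λ l → ∑ xs (λ a → w a l)))))

+-sumℕ : ∀ {k} (f : Fin k → ℕ) → + sumℕ f ≡ sumℤ (λ i → + f i)
+-sumℕ {zero}  f = refl
+-sumℕ {suc k} f = trans (ℤ.pos-+ (f zero) _) (cong (λ z → + f zero + z) (+-sumℕ (λ i → f (suc i))))

Enumerates : {A : Set} → DecidableEquality A → List A → Set
Enumerates _≟_ xs = ∀ c → ∑ xs (λ a → 𝟙 (a ≟ c)) ≡ 1ℤ

module _ {A : Set} (_≟_ : DecidableEquality A) (xs : List A) (enum : Enumerates _≟_ xs) where

  ∑-select : (c : A) (t : A → ℤ) → ∑ xs (λ a → 𝟙 (a ≟ c) * t a) ≡ t c
  ∑-select c t = begin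
    ∑ xs (λ a → 𝟙 (a ≟ c) * t a)  ≡⟨ ∑-cong xs select ⟩
    ∑ xs (λ a → t c * 𝟙 (a ≟ c))  ≡⟨ ∑-*ˡ xs (t c) _ ⟩
    t c * ∑ xs (λ a → 𝟙 (a ≟ c))  ≡⟨ cong (t c *_) (enum c) ⟩
    t c * 1ℤ                       ≡⟨ ℤ.*-identityʳ (t c) ⟩
    t c                            ∎
    where
    open ≡-Reasoning
    select : ∀ a → 𝟙 (a ≟ c) * t a ≡ t c * 𝟙 (a ≟ c)
    select a with a ≟ c
    ... | yes refl = ℤ.*-comm 1ℤ (t a)
    ... | no _     = sym (ℤ.*-zeroʳ (t c))

  ∑-fibres : {B : Set} (ys : List B) (h : B → A) (w : B → ℤ) →
             ∑ ys w ≡ ∑ xs (λ a → ∑ ys (λ b → 𝟙 (a ≟ h b) * w b))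
  ∑-fibres ys h w =
    trans (∑-cong ys (λ b → sym (∑-select (h b) (λ _ → w b)))) (∑-swap ys xs _)

module _ {A B : Set} (_≟A_ : DecidableEquality A) (_≟B_ : DecidableEquality B)
         (xs : List A) (ys : List B) (enumA : Enumerates _≟A_ xs) (enumB : Enumerates _≟B_ ys)
         {P : A → Set} {Q : B → Set} (P? : ∀ a → Dec (P a)) (Q? : ∀ b → Dec (Q b))
         (f : A → B) (g : B → A)
         (P→Q : ∀ a → P a → Q (f a)) (Q→P : ∀ b → Q b → P (g b))
         (g∘f : ∀ a → P a → g (f a) ≡ a) (f∘g : ∀ b → Q b → f (g b) ≡ b) where

  ∑-bijection : (w : A → ℤ) (w′ : B → ℤ) → (∀ a → P a → w′ (f a) ≡ w a) →
                ∑ xs (λ a → 𝟙 (P? a) * w a) ≡ ∑ ys (λ b → 𝟙 (Q? b) * w′ b)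
  ∑-bijection w w′ w′∘f = begin
    ∑ xs (λ a → 𝟙 (P? a) * w a)
      ≡⟨ ∑-fibres _≟B_ ys enumB xs f _ ⟩
    ∑ ys (λ b → ∑ xs (λ a → 𝟙 (b ≟B f a) * (𝟙 (P? a) * w a)))
      ≡⟨ ∑-cong ys (λ b → ∑-cong xs (λ a → graph-swap a b)) ⟩
    ∑ ys (λ b → ∑ xs (λ a → 𝟙 (a ≟A g b) * (𝟙 (Q? b) * w′ b)))
      ≡⟨ ∑-cong ys (λ b → ∑-select _≟A_ xs enumA (g b) _) ⟩
    ∑ ys (λ b → 𝟙 (Q? b) * w′ b) ∎
    where
    open ≡-Reasoning
    0*-absorbs : ∀ x y → x * (0ℤ * y) ≡ 0ℤ
    0*-absorbs x y = ℤ.*-zeroʳ x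
    -- On P × Q the relations b = f a and a = g b coincide.
    graph-swap : ∀ a b → 𝟙 (b ≟B f a) * (𝟙 (P? a) * w a) ≡ 𝟙 (a ≟A g b) * (𝟙 (Q? b) * w′ b)
    graph-swap a b with P? a | b ≟B f a | Q? b | a ≟A g b
    ... | yes p | yes refl | yes _ | yes _   = cong (λ z → 1ℤ * (1ℤ * z)) (sym (w′∘f a p))
    ... | yes p | yes refl | no ¬q | _       = ⊥-elim (¬q (P→Q a p))
    ... | yes p | yes refl | yes _ | no a≢gb = ⊥-elim (a≢gb (sym (g∘f a p)))
    ... | no ¬p | _        | yes q | yes refl = ⊥-elim (¬p (Q→P b q))
    ... | yes _ | no b≢fa  | yes q | yes refl = ⊥-elim (b≢fa (sym (f∘g b q)))
    ... | no _  | d₁       | no _  | d₂      = trans (0*-absorbs (𝟙 d₁) (w a)) (sym (0*-absorbs (𝟙 d₂) (w′ b)))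
    ... | no _  | d₁       | yes _ | no _    = trans (0*-absorbs (𝟙 d₁) (w a)) (sym (ℤ.*-zeroˡ (1ℤ * w′ b)))
    ... | yes _ | no _     | no _  | d₂      = trans (ℤ.*-zeroˡ (1ℤ * w a)) (sym (0*-absorbs (𝟙 d₂) (w′ b)))
    ... | yes _ | no _     | yes _ | no _    = trans (ℤ.*-zeroˡ (1ℤ * w a)) (sym (ℤ.*-zeroˡ (1ℤ * w′ b)))

  ∑-𝟙-bijection : ∑ xs (λ a → 𝟙 (P? a)) ≡ ∑ ys (λ b → 𝟙 (Q? b))
  ∑-𝟙-bijection =
    trans (∑-cong xs (λ a → sym (ℤ.*-identityʳ (𝟙 (P? a)))))
      (trans (∑-bijection (λ _ → 1ℤ) (λ _ → 1ℤ) (λ _ _ → refl))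
        (∑-cong ys (λ b → ℤ.*-identityʳ (𝟙 (Q? b)))))

bools : List Bool
bools = false ∷ true ∷ []

Bool-enumerates : Enumerates _≟B_ bools
Bool-enumerates false = refl
Bool-enumerates true  = refl

allFin-enumerates : ∀ k → Enumerates _≟F_ (allFin k)
allFin-enumerates k c = trans (sym (sumℤ≡∑allFin (λ a → 𝟙 (a ≟F c)))) (hits-once c)
  where
  hits-once : ∀ {k} (c : Fin k) → sumℤ (λ a → 𝟙 (a ≟F c)) ≡ 1ℤ
  hits-once {suc k} zero = cong (λ z → 1ℤ + z) (sumℤ-zero {k} _ (λ i → 𝟙-no (suc i ≟F zero) (λ ())))
  hits-once {suc k} (suc c) =
    trans (cong₂ _+_ (𝟙-no (zero ≟F suc c) (λ ()))
                     (sumℤ-cong (λ i → 𝟙-cong suc-injective (cong suc) (suc i ≟F suc c) (i ≟F c))))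
          (trans (ℤ.+-identityˡ _) (hits-once c))

sumℤ-select : ∀ {k} (j : Fin k) (t : Fin k → ℤ) → sumℤ (λ l → 𝟙 (l ≟F j) * t l) ≡ t j
sumℤ-select {k} j t =
  trans (sumℤ≡∑allFin (λ l → 𝟙 (l ≟F j) * t l)) (∑-select _≟F_ (allFin k) (allFin-enumerates k) j t)

_×≟_ : {A B : Set} → DecidableEquality A → DecidableEquality B → DecidableEquality (A × B)
_≟A_ ×≟ _≟B_ = Product.≡-dec _≟A_ _≟B_

cartesianProduct-enumerates :
  {A B : Set} (_≟A_ : DecidableEquality A) (_≟B_ : DecidableEquality B) (xs : List A) (ys : List B) →
  Enumerates _≟A_ xs → Enumerates _≟B_ ys → Enumerates (_≟A_ ×≟ _≟B_) (cartesianProduct xs ys)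
cartesianProduct-enumerates _≟A_ _≟B_ xs ys enumA enumB (c₁ , c₂) = begin
  ∑ (cartesianProduct xs ys) (λ p → 𝟙 ((_≟A_ ×≟ _≟B_) p (c₁ , c₂)))
    ≡⟨ ∑-cartesianProduct xs ys _ ⟩
  ∑ xs (λ a → ∑ ys (λ b → 𝟙 ((_≟A_ ×≟ _≟B_) (a , b) (c₁ , c₂))))
    ≡⟨ ∑-cong xs (λ a → ∑-cong ys (λ b → trans
         (𝟙-cong Product.,-injective (λ { (refl , refl) → refl }) _ (a ≟A c₁ ×-dec b ≟B c₂))
         (𝟙-× (a ≟A c₁) (b ≟B c₂)))) ⟩
  ∑ xs (λ a → ∑ ys (λ b → 𝟙 (a ≟A c₁) * 𝟙 (b ≟B c₂)))
    ≡⟨ ∑-cong xs (λ a → trans (∑-*ˡ ys (𝟙 (a ≟A c₁)) _) (cong (𝟙 (a ≟A c₁) *_) (enumB c₂))) ⟩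
  ∑ xs (λ a → 𝟙 (a ≟A c₁) * 1ℤ)
    ≡⟨ ∑-select _≟A_ xs enumA c₁ (λ _ → 1ℤ) ⟩
  1ℤ ∎
  where open ≡-Reasoning

allVecs-enumerates : {A : Set} (_≟_ : DecidableEquality A) (xs : List A) → Enumerates _≟_ xs →
                     ∀ k → Enumerates (Vec.≡-dec {n = k} _≟_) (allVecs xs k)
allVecs-enumerates _≟_ xs enum zero    []       = refl
allVecs-enumerates _≟_ xs enum (suc k) (c ∷ cs) = begin
  ∑ (allVecs xs (suc k)) (λ v → 𝟙 (v ≟ⱽ (c ∷ cs)))
    ≡⟨ ∑-concatMap _ xs _ ⟩
  ∑ xs (λ x → ∑ (map (x ∷_) (allVecs xs k)) (λ v → 𝟙 (v ≟ⱽ (c ∷ cs))))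
    ≡⟨ ∑-cong xs (λ x → ∑-map (x ∷_) (allVecs xs k) _) ⟩
  ∑ xs (λ x → ∑ (allVecs xs k) (λ v → 𝟙 ((x ∷ v) ≟ⱽ (c ∷ cs))))
    ≡⟨ ∑-cong xs (λ x → ∑-cong (allVecs xs k) (λ v → trans
         (𝟙-cong Vec.∷-injective (λ { (refl , refl) → refl }) _ (x ≟ c ×-dec Vec.≡-dec _≟_ v cs))
         (𝟙-× (x ≟ c) (Vec.≡-dec _≟_ v cs)))) ⟩
  ∑ xs (λ x → ∑ (allVecs xs k) (λ v → 𝟙 (x ≟ c) * 𝟙 (Vec.≡-dec _≟_ v cs)))
    ≡⟨ ∑-cong xs (λ x → trans (∑-*ˡ (allVecs xs k) (𝟙 (x ≟ c)) _)
                              (cong (𝟙 (x ≟ c) *_) (allVecs-enumerates _≟_ xs enum k cs))) ⟩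
  ∑ xs (λ x → 𝟙 (x ≟ c) * 1ℤ)
    ≡⟨ ∑-select _≟_ xs enum c (λ _ → 1ℤ) ⟩
  1ℤ ∎
  where
  open ≡-Reasoning
  _≟ⱽ_ : DecidableEquality (Vec _ (suc k))
  _≟ⱽ_ = Vec.≡-dec _≟_

_≟S_ : ∀ {n} → DecidableEquality (Vec Bool n)
_≟S_ = Vec.≡-dec _≟B_

_≟C_ : ∀ {n} → DecidableEquality (Cand n)
_≟C_ = _≟S_ ×≟ Vec.≡-dec _≟S_

vertexSets-enumerate : ∀ n → Enumerates _≟S_ (allVecs bools n)
vertexSets-enumerate n = allVecs-enumerates _≟B_ bools Bool-enumerates n

allCands-enumerates : ∀ n → Enumerates (_≟C_ {n}) (allCands n)
allCands-enumerates n = cartesianProduct-enumerates _≟S_ (Vec.≡-dec _≟S_) (allVecs bools n) (allVecs (allVecs bools n) n)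
  (vertexSets-enumerate n) (allVecs-enumerates _≟S_ (allVecs bools n) (vertexSets-enumerate n) n)

pairs : ∀ n → List (Fin n × Fin n)
pairs n = cartesianProduct (allFin n) (allFin n)

pairs-enumerate : ∀ n → Enumerates (_≟F_ ×≟ _≟F_) (pairs n)
pairs-enumerate n = cartesianProduct-enumerates _≟F_ _≟F_ (allFin n) (allFin n) (allFin-enumerates n) (allFin-enumerates n)

false≢true : false ≢ true
false≢true ()

true≢false : true ≢ false
true≢false ()

lookup-ext : {A : Set} {k : ℕ} (xs ys : Vec A k) → (∀ i → lookup xs i ≡ lookup ys i) → xs ≡ ys
lookup-ext xs ys xs≗ys =
  trans (sym (Vec.tabulate∘lookup xs)) (trans (Vec.tabulate-cong xs≗ys) (Vec.tabulate∘lookup ys))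

cand : ∀ {n} → (Fin n → Bool) → (Fin n → Fin n → Bool) → Cand n
cand V E = vtabulate V , vtabulate (λ x → vtabulate (E x))

module _ {n} (V : Fin n → Bool) (E : Fin n → Fin n → Bool) where

  inV-cand : ∀ x → inV (cand V E) x ≡ V x
  inV-cand = Vec.lookup∘tabulate V

  inE-cand : ∀ x y → inE (cand V E) x y ≡ E x y
  inE-cand x y rewrite Vec.lookup∘tabulate (λ x → vtabulate (E x)) x = Vec.lookup∘tabulate (E x) y

vertices : ∀ {n} → Cand n → Vec Bool n
vertices = proj₁

vertices-cand : ∀ {n} (c : Cand n) E → vertices (cand (inV c) E) ≡ vertices c
vertices-cand c E = Vec.tabulate∘lookup (vertices c)

inV-vertices : ∀ {n} (c d : Cand n) → vertices c ≡ vertices d → ∀ u → inV c u ≡ inV d u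
inV-vertices c d c≡d u = cong (λ vs → lookup vs u) c≡d

Cand-ext : ∀ {n} (c c′ : Cand n) → (∀ x → inV c x ≡ inV c′ x) → (∀ x y → inE c x y ≡ inE c′ x y) → c ≡ c′
Cand-ext (vs , es) (vs′ , es′) V≗ E≗ =
  cong₂ _,_ (lookup-ext vs vs′ V≗) (lookup-ext es es′ (λ x → lookup-ext _ _ (E≗ x)))

_⊆ᴱ_ : ∀ {n} → Cand n → Cand n → Set
c ⊆ᴱ d = ∀ x y → inE c x y ≡ true → inE d x y ≡ true

_⊆ᴱ?_ : ∀ {n} (c d : Cand n) → Dec (c ⊆ᴱ d)
c ⊆ᴱ? d = all? (λ x → all? (λ y → (inE c x y ≟B true) →-dec (inE d x y ≟B true)))

Injective : ∀ {s n} → (Fin s → Fin n) → Set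
Injective f = ∀ x y → f x ≡ f y → x ≡ y

injective⇒surjective : ∀ {m} (f : Fin m → Fin m) → Injective f → ∀ u → ∃ λ x → f x ≡ u
injective⇒surjective f f-inj u with any? (λ x → f x ≟F u)
... | yes hit = hit
injective⇒surjective {suc m} f f-inj u | no miss =
  ⊥-elim (ℕ.1+n≰n (injective⇒≤ {f = f′} λ {x} {y} eq → f-inj x y (punchOut-injective (u≢f x) (u≢f y) eq)))
  where
  u≢f : ∀ x → u ≢ f x
  u≢f x eq = miss (x , sym eq)
  f′ : Fin (suc m) → Fin m
  f′ x = punchOut (u≢f x)

preimage : ∀ {s n} (f : Fin s → Fin n) (default : Fin s) → Fin n → Fin s
preimage f default u with any? (λ x → f x ≟F u)
... | yes (x , _) = x
... | no _        = default

f∘preimage : ∀ {s n} (f : Fin s → Fin n) default u → (∃ λ x → f x ≡ u) → f (preimage f default u) ≡ u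
f∘preimage f default u hit with any? (λ x → f x ≟F u)
... | yes (_ , fx≡u) = fx≡u
... | no miss        = ⊥-elim (miss hit)

preimage∘f : ∀ {s n} (f : Fin s → Fin n) default → Injective f → ∀ x → preimage f default (f x) ≡ x
preimage∘f f default f-inj x = f-inj _ _ (f∘preimage f default (f x) (x , refl))

module CopyMap {s n} (A : Rooted s) (v : Fin n) (c : Cand n) (cp : Copy A v c) where

  private
    iso : IsoOnto A v c (proj₁ cp)
    iso = proj₂ cp

  f : Fin s → Fin n
  f = lookup (proj₁ cp)

  f-root : f (root A) ≡ v
  f-root = proj₁ iso

  f-inj : Injective f
  f-inj = proj₁ (proj₂ iso)

  f-into : ∀ x → inV c (f x) ≡ true
  f-into = proj₁ (proj₂ (proj₂ iso))

  f-onto : ∀ u → inV c u ≡ true → ∃ λ x → f x ≡ u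
  f-onto = proj₁ (proj₂ (proj₂ (proj₂ iso)))

  f-adj : ∀ x y → adj (graph A) x y ≡ inE c (f x) (f y)
  f-adj = proj₂ (proj₂ (proj₂ (proj₂ iso)))

copy-by : ∀ {s n} (A : Rooted s) (v : Fin n) (c : Cand n) (f : Fin s → Fin n) →
  f (root A) ≡ v → Injective f → (∀ x → inV c (f x) ≡ true) →
  (∀ u → inV c u ≡ true → ∃ λ x → f x ≡ u) →
  (∀ x y → adj (graph A) x y ≡ inE c (f x) (f y)) → Copy A v c
copy-by A v c f f-root f-inj f-into f-onto f-adj =
  vtabulate f ,
  trans (f∘ (root A)) f-root ,
  (λ x y eq → f-inj x y (trans (sym (f∘ x)) (trans eq (f∘ y)))) ,
  (λ x → trans (cong (inV c) (f∘ x)) (f-into x)) ,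
  (λ u u∈c → let (x , fx≡u) = f-onto u u∈c in x , trans (f∘ x) fx≡u) ,
  (λ x y → trans (f-adj x y) (sym (cong₂ (inE c) (f∘ x) (f∘ y))))
  where
  f∘ : ∀ x → lookup (vtabulate f) x ≡ f x
  f∘ = Vec.lookup∘tabulate f

copy-spanning : ∀ {s} (A : Rooted s) (r : Fin s) (e : Cand s) → Copy A r e → ∀ y → inV e y ≡ true
copy-spanning A r e cp y =
  let (x , fx≡y) = injective⇒surjective f f-inj y in subst (λ z → inV e z ≡ true) fx≡y (f-into x)
  where open CopyMap A r e cp

copies⇒RootedIso : ∀ {s n} {A B : Rooted s} {v : Fin n} {d : Cand n} → Copy A v d → Copy B v d → RootedIso A B
copies⇒RootedIso {A = A} {B} {v} {d} cpA cpB = mk↔ₛ′ to from to∘from from∘to , to-root , to-adj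
  where
  open CopyMap A v d cpA
    renaming (f to f₁; f-root to f₁-root; f-inj to f₁-inj; f-into to f₁-into; f-onto to f₁-onto; f-adj to f₁-adj)
  open CopyMap B v d cpB
    renaming (f to f₂; f-root to f₂-root; f-inj to f₂-inj; f-into to f₂-into; f-onto to f₂-onto; f-adj to f₂-adj)
  to : Fin _ → Fin _
  to x = preimage f₂ (root B) (f₁ x)
  from : Fin _ → Fin _
  from y = preimage f₁ (root A) (f₂ y)
  f₂∘to : ∀ x → f₂ (to x) ≡ f₁ x
  f₂∘to x = f∘preimage f₂ (root B) (f₁ x) (f₂-onto (f₁ x) (f₁-into x))
  f₁∘from : ∀ y → f₁ (from y) ≡ f₂ y
  f₁∘from y = f∘preimage f₁ (root A) (f₂ y) (f₁-onto (f₂ y) (f₂-into y))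
  to∘from : ∀ y → to (from y) ≡ y
  to∘from y = f₂-inj _ _ (trans (f₂∘to (from y)) (f₁∘from y))
  from∘to : ∀ x → from (to x) ≡ x
  from∘to x = f₁-inj _ _ (trans (f₁∘from (to x)) (f₂∘to x))
  to-root : to (root A) ≡ root B
  to-root = f₂-inj _ _ (trans (f₂∘to (root A)) (trans f₁-root (sym f₂-root)))
  to-adj : ∀ x y → adj (graph A) x y ≡ adj (graph B) (to x) (to y)
  to-adj x y = trans (f₁-adj x y) (trans (cong₂ (inE d) (sym (f₂∘to x)) (sym (f₂∘to y))) (sym (f₂-adj (to x) (to y))))

Copy-respects-RootedIso : ∀ {s n} {A B : Rooted s} {v : Fin n} {d : Cand n} → RootedIso A B → Copy B v d → Copy A v d
Copy-respects-RootedIso {A = A} {B} {v} {d} (π , π-root , π-adj) cp =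
  copy-by A v d (λ x → f (to x))
    (trans (cong f π-root) f-root)
    (λ x y eq → trans (sym (strictlyInverseʳ x)) (trans (cong from (f-inj _ _ eq)) (strictlyInverseʳ y)))
    (λ x → f-into (to x))
    (λ u u∈d → let (y , fy≡u) = f-onto u u∈d in from y , trans (cong f (strictlyInverseˡ y)) fy≡u)
    (λ x y → trans (π-adj x y) (f-adj (to x) (to y)))
  where
  open CopyMap B v d cp
  open Inverse π

reachable-mono : ∀ {n} (H H′ : Graph n) → (∀ a b → adj H a b ≡ true → adj H′ a b ≡ true) →
                 ∀ {x y} → Reachable H x y → Reachable H′ x y
reachable-mono H H′ H⊆H′ here         = here
reachable-mono H H′ H⊆H′ (step e r) = step (H⊆H′ _ _ e) (reachable-mono H H′ H⊆H′ r)

subgraph-irreflexive : ∀ {n} (G : Graph n) (d : Cand n) → IsSubgraph G d → ∀ u → inE d u u ≡ false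
subgraph-irreflexive G d d⊆G u =
  ¬-not (λ duu → false≢true (trans (sym (irrfl G u)) (proj₁ (proj₂ d⊆G u u duu))))

module _ {s k} (F : GraphletFamily s k) where

  copy-type-unique : ∀ {n} (v : Fin n) (d : Cand n) (j j′ : Fin k) →
                     Copy (rep F j) v d → Copy (rep F j′) v d → j ≡ j′
  copy-type-unique v d j j′ cp cp′ = distinct F j j′ (copies⇒RootedIso {A = rep F j} {rep F j′} {v} {d} cp cp′)

  -- Read through the map of c, d is a connected graph on Fin s, so some representative is isomorphic to it.
  spanning-supergraph-has-type :
    ∀ {n} (G : Graph n) (v : Fin n) (A : Rooted s) (c d : Cand n) → Connected (graph A) →
    Copy A v c → IsSubgraph G d → vertices c ≡ vertices d → c ⊆ᴱ d → ∃ λ l → Copy (rep F l) v d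
  spanning-supergraph-has-type G v A c d A-conn cp d⊆G c≈d c⊆d =
    let (l , iso) = complete F (H ,root root A) H-conn
    in l , Copy-respects-RootedIso {A = rep F l} {H ,root root A} {v} {d} iso d-copy
    where
    open CopyMap A v c cp
    H : Graph s
    H = record { adj   = λ x y → inE d (f x) (f y)
               ; sym   = λ x y → proj₁ d⊆G (f x) (f y)
               ; irrfl = λ x → subgraph-irreflexive G d d⊆G (f x) }
    H-conn : Connected H
    H-conn x y = reachable-mono (graph A) H (λ a b e → c⊆d _ _ (trans (sym (f-adj a b)) e)) (A-conn x y)
    d-copy : Copy (H ,root root A) v d
    d-copy = copy-by (H ,root root A) v d f f-root f-inj
      (λ x → trans (sym (inV-vertices c d c≈d (f x))) (f-into x))
      (λ u u∈d → f-onto u (trans (inV-vertices c d c≈d u) u∈d))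
      (λ _ _ → refl)

SpanningCopy : ∀ {s n} → Graph n → Cand n → Rooted s → Fin n → Cand n → Set
SpanningCopy G d A v c = IsSubgraph G c × Copy A v c × vertices c ≡ vertices d × c ⊆ᴱ d

spanningCopy? : ∀ {s n} (G : Graph n) (d : Cand n) (A : Rooted s) (v : Fin n) c → Dec (SpanningCopy G d A v c)
spanningCopy? G d A v c = isSubgraph? G c ×-dec copy? A v c ×-dec vertices c ≟S vertices d ×-dec c ⊆ᴱ? d

∑-𝟙-gross : ∀ {s n} (A : Rooted s) (G : Graph n) (v : Fin n) →
            + gross A G v ≡ ∑ (allCands n) (λ c → 𝟙 (isSubgraph? G c ×-dec copy? A v c))
∑-𝟙-gross {n = n} A G v = ∑-count (λ c → isSubgraph? G c ×-dec copy? A v c) (allCands n)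

-- A copy d of B identifies the spanning copies of A inside d with the copies of A in B itself.
module SpanningCopies {s n} (G : Graph n) (d : Cand n) (d⊆G : IsSubgraph G d)
                      (B : Rooted s) (v : Fin n) (d-copy : Copy B v d) (A : Rooted s) where

  open CopyMap B v d d-copy renaming (f to φ; f-root to φ-root; f-inj to φ-inj; f-into to φ-into; f-onto to φ-onto; f-adj to φ-adj)

  inImage? : ∀ u → Dec (∃ λ x → φ x ≡ u)
  inImage? u = any? (λ x → φ x ≟F u)

  pull : Cand n → Cand s
  pull c = cand (λ _ → true) (λ x y → inE c (φ x) (φ y))

  pushE : Cand s → ∀ {u w} → Dec (∃ λ x → φ x ≡ u) → Dec (∃ λ x → φ x ≡ w) → Bool
  pushE e (yes (x , _)) (yes (y , _)) = inE e x y
  pushE e _             _             = false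

  push : Cand s → Cand n
  push e = cand (inV d) (λ u w → pushE e (inImage? u) (inImage? w))

  inE-pull : ∀ c x y → inE (pull c) x y ≡ inE c (φ x) (φ y)
  inE-pull c = inE-cand (λ _ → true) (λ x y → inE c (φ x) (φ y))

  inV-pull : ∀ c x → inV (pull c) x ≡ true
  inV-pull c = inV-cand (λ _ → true) (λ x y → inE c (φ x) (φ y))

  inV-push : ∀ e u → inV (push e) u ≡ inV d u
  inV-push e = inV-cand (inV d) (λ u w → pushE e (inImage? u) (inImage? w))

  inE-push : ∀ e u w → inE (push e) u w ≡ pushE e (inImage? u) (inImage? w)
  inE-push e = inE-cand (inV d) (λ u w → pushE e (inImage? u) (inImage? w))

  inE-push-φ : ∀ e x y → inE (push e) (φ x) (φ y) ≡ inE e x y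
  inE-push-φ e x y rewrite inE-push e (φ x) (φ y) with inImage? (φ x) | inImage? (φ y)
  ... | yes (x′ , φx′≡φx) | yes (y′ , φy′≡φy) rewrite φ-inj _ _ φx′≡φx | φ-inj _ _ φy′≡φy = refl
  ... | no miss | _        = ⊥-elim (miss (x , refl))
  ... | yes _   | no miss = ⊥-elim (miss (y , refl))

  inE-push-true : ∀ e u w → inE (push e) u w ≡ true → ∃ λ x → ∃ λ y → φ x ≡ u × φ y ≡ w × inE e x y ≡ true
  inE-push-true e u w e-uw rewrite inE-push e u w with inImage? u | inImage? w
  ... | yes (x , φx≡u) | yes (y , φy≡w) = x , y , φx≡u , φy≡w , e-uw
  ... | yes _          | no _           = ⊥-elim (false≢true e-uw)
  ... | no _           | _              = ⊥-elim (false≢true e-uw)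

  push-symmetric : ∀ e → (∀ x y → inE e x y ≡ inE e y x) → ∀ u w → inE (push e) u w ≡ inE (push e) w u
  push-symmetric e e-sym u w rewrite inE-push e u w | inE-push e w u with inImage? u | inImage? w
  ... | yes (x , _) | yes (y , _) = e-sym x y
  ... | yes _       | no _        = refl
  ... | no _        | yes _       = refl
  ... | no _        | no _        = refl

  CopyInB : Cand s → Set
  CopyInB e = IsSubgraph (graph B) e × Copy A (root B) e

  copyInB? : ∀ e → Dec (CopyInB e)
  copyInB? e = isSubgraph? (graph B) e ×-dec copy? A (root B) e

  pull-copy : ∀ c → SpanningCopy G d A v c → CopyInB (pull c)
  pull-copy c (c⊆G , cp , c≈d , c⊆d) = (pull-sym , pull-edge) , pulled-copy
    where
    open CopyMap A v c cp renaming (f to ψ; f-root to ψ-root; f-inj to ψ-inj; f-into to ψ-into; f-onto to ψ-onto; f-adj to ψ-adj)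
    pull-sym : ∀ x y → inE (pull c) x y ≡ inE (pull c) y x
    pull-sym x y rewrite inE-pull c x y | inE-pull c y x = proj₁ c⊆G (φ x) (φ y)
    pull-edge : ∀ x y → inE (pull c) x y ≡ true → adj (graph B) x y ≡ true × inV (pull c) x ≡ true × inV (pull c) y ≡ true
    pull-edge x y e rewrite inE-pull c x y = trans (φ-adj x y) (c⊆d _ _ e) , inV-pull c x , inV-pull c y
    χ : Fin s → Fin s
    χ x = preimage φ (root B) (ψ x)
    φ∘χ : ∀ x → φ (χ x) ≡ ψ x
    φ∘χ x = f∘preimage φ (root B) (ψ x) (φ-onto (ψ x) (trans (sym (inV-vertices c d c≈d (ψ x))) (ψ-into x)))
    pulled-copy : Copy A (root B) (pull c)
    pulled-copy = copy-by A (root B) (pull c) χ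
      (φ-inj _ _ (trans (φ∘χ (root A)) (trans ψ-root (sym φ-root))))
      (λ x y eq → ψ-inj x y (trans (sym (φ∘χ x)) (trans (cong φ eq) (φ∘χ y))))
      (λ x → inV-pull c (χ x))
      (λ u _ → let (x , ψx≡φu) = ψ-onto (φ u) (trans (inV-vertices c d c≈d (φ u)) (φ-into u))
               in x , φ-inj _ _ (trans (φ∘χ x) ψx≡φu))
      (λ x y → trans (ψ-adj x y) (trans (cong₂ (inE c) (sym (φ∘χ x)) (sym (φ∘χ y))) (sym (inE-pull c (χ x) (χ y)))))

  push-copy : ∀ e → CopyInB e → SpanningCopy G d A v (push e)
  push-copy e ((e-sym , e⊆B) , cp) =
    (push-symmetric e e-sym , push-edge) , pushed-copy , vertices-cand d (λ u w → pushE e (inImage? u) (inImage? w)) , push⊆d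
    where
    open CopyMap A (root B) e cp renaming (f to χ; f-root to χ-root; f-inj to χ-inj; f-into to χ-into; f-adj to χ-adj)
    push⊆d : push e ⊆ᴱ d
    push⊆d u w e-uw with inE-push-true e u w e-uw
    ... | x , y , refl , refl , e-xy = trans (sym (φ-adj x y)) (proj₁ (e⊆B x y e-xy))
    push-edge : ∀ u w → inE (push e) u w ≡ true → adj G u w ≡ true × inV (push e) u ≡ true × inV (push e) w ≡ true
    push-edge u w e-uw rewrite inV-push e u | inV-push e w = proj₂ d⊆G u w (push⊆d u w e-uw)
    pushed-copy : Copy A v (push e)
    pushed-copy = copy-by A v (push e) (λ x → φ (χ x))
      (trans (cong φ χ-root) φ-root)
      (λ x y eq → χ-inj x y (φ-inj _ _ eq))
      (λ x → trans (inV-push e (φ (χ x))) (φ-into (χ x)))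
      (λ u u∈e → let (y , φy≡u) = φ-onto u (trans (sym (inV-push e u)) u∈e)
                     (x , χx≡y) = injective⇒surjective χ χ-inj y
                 in x , trans (cong φ χx≡y) φy≡u)
      (λ x y → trans (χ-adj x y) (sym (inE-push-φ e (χ x) (χ y))))

  push∘pull : ∀ c → SpanningCopy G d A v c → push (pull c) ≡ c
  push∘pull c (c⊆G , _ , c≈d , _) = Cand-ext _ _
    (λ u → trans (inV-push (pull c) u) (sym (inV-vertices c d c≈d u)))
    edge
    where
    outside : ∀ u → ¬ (∃ λ x → φ x ≡ u) → inV c u ≢ true
    outside u miss u∈c = miss (φ-onto u (trans (sym (inV-vertices c d c≈d u)) u∈c))
    edge : ∀ u w → inE (push (pull c)) u w ≡ inE c u w
    edge u w rewrite inE-push (pull c) u w with inImage? u | inImage? w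
    ... | yes (x , refl) | yes (y , refl) = inE-pull c x y
    ... | no miss | _        = sym (¬-not (λ e → outside u miss (proj₁ (proj₂ (proj₂ c⊆G u w e)))))
    ... | yes _   | no miss = sym (¬-not (λ e → outside w miss (proj₂ (proj₂ (proj₂ c⊆G u w e)))))

  pull∘push : ∀ e → CopyInB e → pull (push e) ≡ e
  pull∘push e (_ , cp) = Cand-ext _ _
    (λ x → trans (inV-pull (push e) x) (sym (copy-spanning A (root B) e cp x)))
    (λ x y → trans (inE-pull (push e) x y) (inE-push-φ e x y))

  spanning-copies-count : ∑ (allCands n) (λ c → 𝟙 (spanningCopy? G d A v c)) ≡ + gross A (graph B) (root B)
  spanning-copies-count =
    trans (∑-𝟙-bijection _≟C_ _≟C_ (allCands n) (allCands s) (allCands-enumerates n) (allCands-enumerates s)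
             (spanningCopy? G d A v) copyInB? pull push pull-copy push-copy push∘pull pull∘push)
          (sym (∑-𝟙-gross A (graph B) (root B)))

arcs : ∀ {n} → Cand n → ℕ
arcs {n} d = count (λ (u , w) → inE d u w ≟B true) (pairs n)

graphArcs : ∀ {s} → Graph s → ℕ
graphArcs {s} H = count (λ (x , y) → adj H x y ≟B true) (pairs s)

-- Ordered pairs count each edge twice, so halfSign (arcs d) is (-1) to the number of edges of d;
-- working with arcs makes toggling one edge a change by exactly 2.
halfSign : ℕ → ℤ
halfSign zero          = 1ℤ
halfSign (suc zero)    = 1ℤ
halfSign (suc (suc m)) = - halfSign m

σ : ∀ {n} → Cand n → ℤ
σ d = halfSign (arcs d)

halfSign-double : ∀ m → halfSign (m ℕ.+ m) ≡ sign m
halfSign-double zero    = refl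
halfSign-double (suc m) rewrite ℕ.+-suc m m = cong -_ (halfSign-double m)

graphArcs≡2·edges : ∀ {s} (H : Graph s) → graphArcs H ≡ edges H ℕ.+ edges H
graphArcs≡2·edges {s} H = ℤ.+-injective (begin
  + graphArcs H                                    ≡⟨ ∑-count A? (pairs s) ⟩
  ∑ (pairs s) (λ p → 𝟙 (A? p))                     ≡⟨ ∑-cong (pairs s) split ⟩
  ∑ (pairs s) (λ p → 𝟙 (A<? p) + 𝟙 (A>? p))        ≡⟨ ∑-+ (pairs s) _ _ ⟩
  ∑ (pairs s) (λ p → 𝟙 (A<? p)) + ∑ (pairs s) (λ p → 𝟙 (A>? p))
    ≡⟨ cong (λ z → ∑ (pairs s) (λ p → 𝟙 (A<? p)) + z) swap-pairs ⟩
  ∑ (pairs s) (λ p → 𝟙 (A<? p)) + ∑ (pairs s) (λ p → 𝟙 (A<? p))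
    ≡⟨ cong₂ _+_ (sym (∑-count A<? (pairs s))) (sym (∑-count A<? (pairs s))) ⟩
  + edges H + + edges H                            ≡⟨ sym (ℤ.pos-+ (edges H) (edges H)) ⟩
  + (edges H ℕ.+ edges H)                          ∎)
  where
  open ≡-Reasoning
  A? : (p : Fin s × Fin s) → Dec (adj H (proj₁ p) (proj₂ p) ≡ true)
  A<? : (p : Fin s × Fin s) → Dec (proj₁ p <ᶠ proj₂ p × adj H (proj₁ p) (proj₂ p) ≡ true)
  A>? : (p : Fin s × Fin s) → Dec (proj₂ p <ᶠ proj₁ p × adj H (proj₁ p) (proj₂ p) ≡ true)
  A? (x , y) = adj H x y ≟B true
  A<? (x , y) = (x <? y) ×-dec (adj H x y ≟B true)
  A>? (x , y) = (y <? x) ×-dec (adj H x y ≟B true)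
  split : ∀ p → 𝟙 (A? p) ≡ 𝟙 (A<? p) + 𝟙 (A>? p)
  split (x , y) with <-cmp x y
  ... | tri< x<y _ _ = trans (𝟙-cong (x<y ,_) proj₂ (A? (x , y)) (A<? (x , y)))
         (sym (trans (cong (λ z → 𝟙 (A<? (x , y)) + z) (𝟙-no (A>? (x , y)) (λ (y<x , _) → <-asym x<y y<x)))
                     (ℤ.+-identityʳ _)))
  ... | tri> _ _ y<x = trans (𝟙-cong (y<x ,_) proj₂ (A? (x , y)) (A>? (x , y)))
         (sym (trans (cong (_+ 𝟙 (A>? (x , y))) (𝟙-no (A<? (x , y)) (λ (x<y , _) → <-asym y<x x<y)))
                     (ℤ.+-identityˡ _)))
  ... | tri≈ _ refl _ = trans (𝟙-no (A? (x , x)) (λ e → false≢true (trans (sym (irrfl H x)) e)))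
         (sym (cong₂ _+_ (𝟙-no (A<? (x , x)) (λ (x<x , _) → <-irrefl refl x<x))
                         (𝟙-no (A>? (x , x)) (λ (x<x , _) → <-irrefl refl x<x))))
  flip : Fin s × Fin s → Fin s × Fin s
  flip (x , y) = y , x
  swap-pairs : ∑ (pairs s) (λ p → 𝟙 (A>? p)) ≡ ∑ (pairs s) (λ p → 𝟙 (A<? p))
  swap-pairs = ∑-𝟙-bijection (_≟F_ ×≟ _≟F_) (_≟F_ ×≟ _≟F_) (pairs s) (pairs s) (pairs-enumerate s) (pairs-enumerate s)
    A>? A<? flip flip
    (λ (x , y) (y<x , e) → y<x , trans (adj-sym H y x) e)
    (λ (x , y) (x<y , e) → x<y , trans (adj-sym H y x) e)
    (λ _ _ → refl) (λ _ _ → refl)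

graphArcs≡arcs : ∀ {s n} (G : Graph n) (B : Rooted s) (v : Fin n) (d : Cand n) →
                 Copy B v d → IsSubgraph G d → graphArcs (graph B) ≡ arcs d
graphArcs≡arcs {s} {n} G B v d cp d⊆G = ℤ.+-injective (trans (∑-count B? (pairs s))
  (trans (∑-𝟙-bijection (_≟F_ ×≟ _≟F_) (_≟F_ ×≟ _≟F_) (pairs s) (pairs n) (pairs-enumerate s) (pairs-enumerate n)
            B? d? f² f⁻¹² (λ (x , y) e → trans (sym (f-adj x y)) e) d→B
            (λ (x , y) _ → cong₂ _,_ (preimage∘f f (root B) f-inj x) (preimage∘f f (root B) f-inj y))
            (λ (u , w) e → let (_ , u∈d , w∈d) = proj₂ d⊆G u w e in cong₂ _,_ (f∘f⁻¹ u u∈d) (f∘f⁻¹ w w∈d)))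
         (sym (∑-count d? (pairs n)))))
  where
  open CopyMap B v d cp
  B? : (p : Fin s × Fin s) → Dec (adj (graph B) (proj₁ p) (proj₂ p) ≡ true)
  B? (x , y) = adj (graph B) x y ≟B true
  d? : (p : Fin n × Fin n) → Dec (inE d (proj₁ p) (proj₂ p) ≡ true)
  d? (u , w) = inE d u w ≟B true
  f² : Fin s × Fin s → Fin n × Fin n
  f² (x , y) = f x , f y
  f⁻¹ : Fin n → Fin s
  f⁻¹ = preimage f (root B)
  f⁻¹² : Fin n × Fin n → Fin s × Fin s
  f⁻¹² (u , w) = f⁻¹ u , f⁻¹ w
  f∘f⁻¹ : ∀ u → inV d u ≡ true → f (f⁻¹ u) ≡ u
  f∘f⁻¹ u u∈d = f∘preimage f (root B) u (f-onto u u∈d)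
  d→B : ∀ p → inE d (proj₁ p) (proj₂ p) ≡ true → adj (graph B) (f⁻¹ (proj₁ p)) (f⁻¹ (proj₂ p)) ≡ true
  d→B (u , w) e = let (_ , u∈d , w∈d) = proj₂ d⊆G u w e in
    trans (f-adj (f⁻¹ u) (f⁻¹ w)) (trans (cong₂ (inE d) (f∘f⁻¹ u u∈d) (f∘f⁻¹ w w∈d)) e)

σ-copy : ∀ {s n} (G : Graph n) (B : Rooted s) (v : Fin n) (d : Cand n) →
         Copy B v d → IsSubgraph G d → σ d ≡ sign (edges (graph B))
σ-copy G B v d cp d⊆G = begin
  halfSign (arcs d)                          ≡⟨ cong halfSign (sym (graphArcs≡arcs G B v d cp d⊆G)) ⟩
  halfSign (graphArcs (graph B))             ≡⟨ cong halfSign (graphArcs≡2·edges (graph B)) ⟩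
  halfSign (edges (graph B) ℕ.+ edges (graph B)) ≡⟨ halfSign-double (edges (graph B)) ⟩
  sign (edges (graph B))                     ∎
  where open ≡-Reasoning

SpanningSupergraph : ∀ {n} → Graph n → Cand n → Cand n → Set
SpanningSupergraph G c d = IsSubgraph G d × vertices d ≡ vertices c × c ⊆ᴱ d

spanningSupergraph? : ∀ {n} (G : Graph n) (c d : Cand n) → Dec (SpanningSupergraph G c d)
spanningSupergraph? G c d = isSubgraph? G d ×-dec vertices d ≟S vertices c ×-dec c ⊆ᴱ? d

module Toggle {n} (x y : Fin n) where

  _≡ᵇ_ : Fin n → Fin n → Bool
  u ≡ᵇ w = does (u ≟F w)

  ≡ᵇ⇒≡ : ∀ {u w} → u ≡ᵇ w ≡ true → u ≡ w
  ≡ᵇ⇒≡ {u} {w} e with u ≟F w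
  ... | yes u≡w = u≡w

  ≡ᵇ-refl : ∀ u → u ≡ᵇ u ≡ true
  ≡ᵇ-refl u with u ≟F u
  ... | yes _   = refl
  ... | no u≢u = ⊥-elim (u≢u refl)

  isXY : Fin n → Fin n → Bool
  isXY u w = (u ≡ᵇ x ∧ w ≡ᵇ y) ∨ (u ≡ᵇ y ∧ w ≡ᵇ x)

  isXY-sym : ∀ u w → isXY u w ≡ isXY w u
  isXY-sym u w = trans (∨-comm (u ≡ᵇ x ∧ w ≡ᵇ y) _)
                       (cong₂ _∨_ (∧-comm (u ≡ᵇ y) (w ≡ᵇ x)) (∧-comm (u ≡ᵇ x) (w ≡ᵇ y)))

  isXY-xy : isXY x y ≡ true
  isXY-xy rewrite ≡ᵇ-refl x | ≡ᵇ-refl y = refl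

  isXY-true : ∀ u w → isXY u w ≡ true → (u ≡ x × w ≡ y) ⊎ (u ≡ y × w ≡ x)
  isXY-true u w e with u ≡ᵇ x in ux | w ≡ᵇ y in wy | u ≡ᵇ y in uy | w ≡ᵇ x in wx
  ... | true | true | _    | _    = inj₁ (≡ᵇ⇒≡ ux , ≡ᵇ⇒≡ wy)
  ... | true | false | true | true = inj₂ (≡ᵇ⇒≡ uy , ≡ᵇ⇒≡ wx)
  ... | false | _   | true | true = inj₂ (≡ᵇ⇒≡ uy , ≡ᵇ⇒≡ wx)

  isXY-false : ∀ u w → isXY u w ≡ false → ¬ ((u ≡ x × w ≡ y) ⊎ (u ≡ y × w ≡ x))
  isXY-false u w e (inj₁ (refl , refl)) = true≢false (trans (sym isXY-xy) e)
  isXY-false u w e (inj₂ (refl , refl)) = true≢false (trans (sym isXY-xy) (trans (isXY-sym x y) e))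

  toggle : Cand n → Cand n
  toggle d = cand (inV d) (λ u w → isXY u w xor inE d u w)

  inV-toggle : ∀ d u → inV (toggle d) u ≡ inV d u
  inV-toggle d = inV-cand (inV d) (λ u w → isXY u w xor inE d u w)

  inE-toggle : ∀ d u w → inE (toggle d) u w ≡ isXY u w xor inE d u w
  inE-toggle d = inE-cand (inV d) (λ u w → isXY u w xor inE d u w)

  inE-toggle-xy : ∀ d → inE (toggle d) x y ≡ not (inE d x y)
  inE-toggle-xy d rewrite inE-toggle d x y | isXY-xy = refl

  inE-toggle-off : ∀ d u w → isXY u w ≡ false → inE (toggle d) u w ≡ inE d u w
  inE-toggle-off d u w off = trans (inE-toggle d u w) (cong (_xor inE d u w) off)

  toggle-involutive : ∀ d → toggle (toggle d) ≡ d
  toggle-involutive d = Cand-ext _ _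
    (λ u → trans (inV-toggle (toggle d) u) (inV-toggle d u))
    (λ u w → begin
      inE (toggle (toggle d)) u w          ≡⟨ inE-toggle (toggle d) u w ⟩
      isXY u w xor inE (toggle d) u w      ≡⟨ cong (isXY u w xor_) (inE-toggle d u w) ⟩
      isXY u w xor (isXY u w xor inE d u w) ≡⟨ sym (xor-assoc (isXY u w) _ _) ⟩
      (isXY u w xor isXY u w) xor inE d u w ≡⟨ cong (_xor inE d u w) (xor-same (isXY u w)) ⟩
      inE d u w                            ∎)
    where open ≡-Reasoning

  arcs-toggle : x ≢ y → ∀ d → (∀ u w → inE d u w ≡ inE d w u) → inE d x y ≡ false → arcs (toggle d) ≡ 2 ℕ.+ arcs d
  arcs-toggle x≢y d d-sym dxy = ℤ.+-injective (begin
    + arcs (toggle d)                          ≡⟨ ∑-count T? (pairs n) ⟩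
    ∑ (pairs n) (λ p → 𝟙 (T? p))               ≡⟨ ∑-cong (pairs n) split ⟩
    ∑ (pairs n) (λ p → 𝟙 (D? p) + (𝟙 (p ≟² (x , y)) + 𝟙 (p ≟² (y , x))))
      ≡⟨ ∑-+ (pairs n) _ _ ⟩
    ∑ (pairs n) (λ p → 𝟙 (D? p)) + ∑ (pairs n) (λ p → 𝟙 (p ≟² (x , y)) + 𝟙 (p ≟² (y , x)))
      ≡⟨ cong₂ _+_ (sym (∑-count D? (pairs n))) (∑-+ (pairs n) _ _) ⟩
    + arcs d + (∑ (pairs n) (λ p → 𝟙 (p ≟² (x , y))) + ∑ (pairs n) (λ p → 𝟙 (p ≟² (y , x))))
      ≡⟨ cong (λ z → + arcs d + z) (cong₂ _+_ (pairs-enumerate n (x , y)) (pairs-enumerate n (y , x))) ⟩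
    + arcs d + + 2                             ≡⟨ ℤ.+-comm (+ arcs d) (+ 2) ⟩
    + (2 ℕ.+ arcs d)                           ∎)
    where
    open ≡-Reasoning
    _≟²_ : DecidableEquality (Fin n × Fin n)
    _≟²_ = _≟F_ ×≟ _≟F_
    T? : (p : Fin n × Fin n) → Dec (inE (toggle d) (proj₁ p) (proj₂ p) ≡ true)
    D? : (p : Fin n × Fin n) → Dec (inE d (proj₁ p) (proj₂ p) ≡ true)
    T? (u , w) = inE (toggle d) u w ≟B true
    D? (u , w) = inE d u w ≟B true
    dyx : inE d y x ≡ false
    dyx = trans (d-sym y x) dxy
    split : ∀ p → 𝟙 (T? p) ≡ 𝟙 (D? p) + (𝟙 (p ≟² (x , y)) + 𝟙 (p ≟² (y , x)))
    split (u , w) with isXY u w in uw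
    ... | false = trans (𝟙-cong (trans (sym (inE-toggle-off d u w uw))) (trans (inE-toggle-off d u w uw))
                                (T? (u , w)) (D? (u , w)))
                        (sym (trans (cong (λ z → 𝟙 (D? (u , w)) + z)
                               (cong₂ _+_ (𝟙-no ((u , w) ≟² (x , y)) (λ { refl → isXY-false u w uw (inj₁ (refl , refl)) }))
                                          (𝟙-no ((u , w) ≟² (y , x)) (λ { refl → isXY-false u w uw (inj₂ (refl , refl)) }))))
                             (ℤ.+-identityʳ _)))
    ... | true with isXY-true u w uw
    ...   | inj₁ (refl , refl) = trans (𝟙-yes (T? (x , y)) (trans (inE-toggle-xy d) (cong not dxy)))
              (sym (cong₂ _+_ (𝟙-no (D? (x , y)) (λ e → true≢false (trans (sym e) dxy)))
                              (cong₂ _+_ (𝟙-yes ((x , y) ≟² (x , y)) refl)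
                                         (𝟙-no ((x , y) ≟² (y , x)) (λ e → x≢y (cong proj₁ e))))))
    ...   | inj₂ (refl , refl) =
            trans (𝟙-yes (T? (y , x)) (trans (inE-toggle d y x) (trans (cong (_xor inE d y x) uw) (cong not dyx))))
              (sym (cong₂ _+_ (𝟙-no (D? (y , x)) (λ e → true≢false (trans (sym e) dyx)))
                              (cong₂ _+_ (𝟙-no ((y , x) ≟² (x , y)) (λ e → x≢y (sym (cong proj₁ e))))
                                         (𝟙-yes ((y , x) ≟² (y , x)) refl))))

  σ-toggle : x ≢ y → ∀ d → (∀ u w → inE d u w ≡ inE d w u) → inE d x y ≡ false → σ (toggle d) ≡ - σ d
  σ-toggle x≢y d d-sym dxy rewrite arcs-toggle x≢y d d-sym dxy = refl

MissingEdgeAt : ∀ {n} → Graph n → Cand n → Fin n → Fin n → Set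
MissingEdgeAt G c x y = inV c x ≡ true × inV c y ≡ true × adj G x y ≡ true × inE c x y ≡ false

MissingEdge : ∀ {n} → Graph n → Cand n → Set
MissingEdge G c = ∃ λ x → ∃ λ y → MissingEdgeAt G c x y

missingEdge? : ∀ {n} (G : Graph n) (c : Cand n) → Dec (MissingEdge G c)
missingEdge? G c = any? λ x → any? λ y →
  (inV c x ≟B true) ×-dec (inV c y ≟B true) ×-dec (adj G x y ≟B true) ×-dec (inE c x y ≟B false)

module _ {n} (G : Graph n) (c : Cand n) (c⊆G : IsSubgraph G c) where

  no-missingEdge⇒induced : ¬ MissingEdge G c → IsInduced G c
  no-missingEdge⇒induced none x y x∈c y∈c with adj G x y in xy
  ... | true  = ¬-not (λ cxy → none (x , y , x∈c , y∈c , xy , cxy))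
  ... | false = ¬-not (λ cxy → true≢false (trans (sym (proj₁ (proj₂ c⊆G x y cxy))) xy))

  induced⇒spanningSupergraph-unique : IsInduced G c → ∀ d → SpanningSupergraph G c d → d ≡ c
  induced⇒spanningSupergraph-unique c-ind d (d⊆G , d≈c , c⊆d) = Cand-ext d c (inV-vertices d c d≈c) edge
    where
    edge : ∀ u w → inE d u w ≡ inE c u w
    edge u w with inE d u w in duw
    ... | true  = let (Guw , u∈d , w∈d) = proj₂ d⊆G u w duw in
                  sym (trans (c-ind u w (trans (sym (inV-vertices d c d≈c u)) u∈d)
                                        (trans (sym (inV-vertices d c d≈c w)) w∈d)) Guw)
    ... | false = sym (¬-not (λ cuw → true≢false (trans (sym (c⊆d u w cuw)) duw)))

  ∑-σ-spanningSupergraphs-induced : IsInduced G c →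
    ∑ (allCands n) (λ d → 𝟙 (spanningSupergraph? G c d) * σ d) ≡ σ c
  ∑-σ-spanningSupergraphs-induced c-ind =
    trans (∑-cong (allCands n) (λ d → cong (_* σ d)
            (𝟙-cong (induced⇒spanningSupergraph-unique c-ind d) (λ { refl → c⊆G , refl , (λ _ _ e → e) })
                    (spanningSupergraph? G c d) (d ≟C c))))
          (∑-select _≟C_ (allCands n) (allCands-enumerates n) c σ)

  toggle-spanning : ∀ x y → MissingEdgeAt G c x y →
                    ∀ d → SpanningSupergraph G c d → SpanningSupergraph G c (Toggle.toggle x y d)
  toggle-spanning x y (x∈c , y∈c , Gxy , cxy) d ((d-sym , d⊆G) , d≈c , c⊆d) =
    (t-sym , t⊆G) , trans (vertices-cand d (λ u w → isXY u w xor inE d u w)) d≈c , c⊆t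
    where
    open Toggle x y
    t-sym : ∀ u w → inE (toggle d) u w ≡ inE (toggle d) w u
    t-sym u w rewrite inE-toggle d u w | inE-toggle d w u | isXY-sym u w | d-sym u w = refl
    t⊆G : ∀ u w → inE (toggle d) u w ≡ true → adj G u w ≡ true × inV (toggle d) u ≡ true × inV (toggle d) w ≡ true
    t⊆G u w e rewrite inV-toggle d u | inV-toggle d w with isXY u w in uw
    ... | false = d⊆G u w (trans (sym (inE-toggle-off d u w uw)) e)
    ... | true with isXY-true u w uw
    ...   | inj₁ (refl , refl) = Gxy , trans (inV-vertices d c d≈c x) x∈c , trans (inV-vertices d c d≈c y) y∈c
    ...   | inj₂ (refl , refl) =
            trans (adj-sym G y x) Gxy , trans (inV-vertices d c d≈c y) y∈c , trans (inV-vertices d c d≈c x) x∈c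
    c⊆t : c ⊆ᴱ toggle d
    c⊆t u w e with isXY u w in uw
    ... | false = trans (inE-toggle-off d u w uw) (c⊆d u w e)
    ... | true with isXY-true u w uw
    ...   | inj₁ (refl , refl) = ⊥-elim (true≢false (trans (sym e) cxy))
    ...   | inj₂ (refl , refl) = ⊥-elim (true≢false (trans (sym e) (trans (proj₁ c⊆G y x) cxy)))

  -- Toggling a missing edge xy is a sign-reversing involution on the spanning supergraphs.
  ∑-σ-spanningSupergraphs-missing : MissingEdge G c →
    ∑ (allCands n) (λ d → 𝟙 (spanningSupergraph? G c d) * σ d) ≡ 0ℤ
  ∑-σ-spanningSupergraphs-missing (x , y , x∈c , y∈c , Gxy , cxy) = begin
    ∑ C (λ d → 𝟙 (R? d) * σ d)
      ≡⟨ ∑-cong C (λ d → trans (cong (_* σ d) (𝟙-split (R? d) (inE d x y)))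
                               (ℤ.*-distribʳ-+ (σ d) (𝟙 (hasXY? d)) (𝟙 (lacksXY? d)))) ⟩
    ∑ C (λ d → 𝟙 (hasXY? d) * σ d + 𝟙 (lacksXY? d) * σ d)
      ≡⟨ ∑-+ C _ _ ⟩
    ∑ C (λ d → 𝟙 (hasXY? d) * σ d) + ∑ C (λ d → 𝟙 (lacksXY? d) * σ d)
      ≡⟨ cong (_+ ∑ C (λ d → 𝟙 (lacksXY? d) * σ d)) toggle-pairs ⟩
    ∑ C (λ d → 𝟙 (lacksXY? d) * - σ d) + ∑ C (λ d → 𝟙 (lacksXY? d) * σ d)
      ≡⟨ sym (∑-+ C _ _) ⟩
    ∑ C (λ d → 𝟙 (lacksXY? d) * - σ d + 𝟙 (lacksXY? d) * σ d)
      ≡⟨ ∑-zero C _ (λ d → cancel (𝟙 (lacksXY? d)) (σ d)) ⟩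
    0ℤ ∎
    where
    open ≡-Reasoning
    open Toggle x y
    C : List (Cand n)
    C = allCands n
    R? : ∀ d → Dec (SpanningSupergraph G c d)
    R? = spanningSupergraph? G c
    cancel : ∀ a b → a * - b + a * b ≡ 0ℤ
    cancel = solve-∀
    x≢y : x ≢ y
    x≢y refl = true≢false (trans (sym Gxy) (irrfl G x))
    hasXY? : ∀ d → Dec (SpanningSupergraph G c d × inE d x y ≡ true)
    lacksXY? : ∀ d → Dec (SpanningSupergraph G c d × inE d x y ≡ false)
    hasXY? d = R? d ×-dec (inE d x y ≟B true)
    lacksXY? d = R? d ×-dec (inE d x y ≟B false)
    toggle-flips : ∀ d b → SpanningSupergraph G c d × inE d x y ≡ b →
                   SpanningSupergraph G c (toggle d) × inE (toggle d) x y ≡ not b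
    toggle-flips d b (R , dxy) = toggle-spanning x y (x∈c , y∈c , Gxy , cxy) d R , trans (inE-toggle-xy d) (cong not dxy)
    σ-flips : ∀ d → SpanningSupergraph G c d × inE d x y ≡ true → - σ (toggle d) ≡ σ d
    σ-flips d h = sym (trans (cong σ (sym (toggle-involutive d)))
                             (σ-toggle x≢y (toggle d) (proj₁ (proj₁ (proj₁ flipped))) (proj₂ flipped)))
      where
      flipped : SpanningSupergraph G c (toggle d) × inE (toggle d) x y ≡ false
      flipped = toggle-flips d true h
    toggle-pairs : ∑ C (λ d → 𝟙 (hasXY? d) * σ d) ≡ ∑ C (λ d → 𝟙 (lacksXY? d) * - σ d)
    toggle-pairs = ∑-bijection _≟C_ _≟C_ C C (allCands-enumerates n) (allCands-enumerates n)
      hasXY? lacksXY? toggle toggle (λ d → toggle-flips d true) (λ d → toggle-flips d false)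
      (λ d _ → toggle-involutive d) (λ d _ → toggle-involutive d) σ (λ d → - σ d) σ-flips

  ∑-σ-spanningSupergraphs : ∑ (allCands n) (λ d → 𝟙 (spanningSupergraph? G c d) * σ d) ≡ 𝟙 (isInduced? G c) * σ c
  ∑-σ-spanningSupergraphs with missingEdge? G c
  ... | no none = trans (∑-σ-spanningSupergraphs-induced (no-missingEdge⇒induced none))
                        (sym (trans (cong (_* σ c) (𝟙-yes (isInduced? G c) (no-missingEdge⇒induced none))) (ℤ.*-identityˡ (σ c))))
  ... | yes (x , y , x∈c , y∈c , Gxy , cxy) =
    trans (∑-σ-spanningSupergraphs-missing (x , y , x∈c , y∈c , Gxy , cxy))
          (sym (cong (_* σ c) (𝟙-no (isInduced? G c)
            (λ c-ind → true≢false (trans (sym Gxy) (trans (sym (c-ind x y x∈c y∈c)) cxy))))))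

module InducedSubgraph {n} (G : Graph n) where

  induced : Vec Bool n → Cand n
  induced S = cand (lookup S) (λ x y → lookup S x ∧ lookup S y ∧ adj G x y)

  inV-induced : ∀ S x → inV (induced S) x ≡ lookup S x
  inV-induced S = inV-cand (lookup S) (λ x y → lookup S x ∧ lookup S y ∧ adj G x y)

  inE-induced : ∀ S x y → inE (induced S) x y ≡ (lookup S x ∧ lookup S y ∧ adj G x y)
  inE-induced S = inE-cand (lookup S) (λ x y → lookup S x ∧ lookup S y ∧ adj G x y)

  vertices-induced : ∀ S → vertices (induced S) ≡ S
  vertices-induced S = Vec.tabulate∘lookup S

  induced-subgraph : ∀ S → IsSubgraph G (induced S)
  induced-subgraph S = induced-sym , induced-edge
    where
    induced-sym : ∀ x y → inE (induced S) x y ≡ inE (induced S) y x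
    induced-sym x y rewrite inE-induced S x y | inE-induced S y x | adj-sym G x y
      with lookup S x | lookup S y
    ... | false | false = refl
    ... | false | true  = refl
    ... | true  | false = refl
    ... | true  | true  = refl
    induced-edge : ∀ x y → inE (induced S) x y ≡ true →
                   adj G x y ≡ true × inV (induced S) x ≡ true × inV (induced S) y ≡ true
    induced-edge x y e rewrite inV-induced S x | inV-induced S y with lookup S x | lookup S y | adj G x y | inE-induced S x y
    ... | true | true | true | _ = refl , refl , refl
    ... | true | true | false | exy = ⊥-elim (true≢false (trans (sym e) exy))
    ... | true | false | _ | exy = ⊥-elim (true≢false (trans (sym e) exy))
    ... | false | _ | _ | exy = ⊥-elim (true≢false (trans (sym e) exy))

  induced-induced : ∀ S → IsInduced G (induced S)
  induced-induced S x y x∈S y∈S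
    rewrite inE-induced S x y | trans (sym (inV-induced S x)) x∈S | trans (sym (inV-induced S y)) y∈S = refl

  induced-vertices : ∀ c → IsSubgraph G c → IsInduced G c → induced (vertices c) ≡ c
  induced-vertices c c⊆G c-ind =
    Cand-ext _ _ (inV-induced (vertices c)) (λ x y → trans (inE-induced (vertices c) x y) (edge x y))
    where
    edge : ∀ x y → (inV c x ∧ inV c y ∧ adj G x y) ≡ inE c x y
    edge x y with inV c x in x∈c | inV c y in y∈c
    ... | true  | true  = sym (c-ind x y x∈c y∈c)
    ... | false | _     = sym (¬-not (λ e → true≢false (trans (sym (proj₁ (proj₂ (proj₂ c⊆G x y e)))) x∈c)))
    ... | true  | false = sym (¬-not (λ e → true≢false (trans (sym (proj₂ (proj₂ (proj₂ c⊆G x y e)))) y∈c)))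

  ∑-𝟙-net : ∀ {s} (A : Rooted s) (v : Fin n) →
            + net A G v ≡ ∑ (allVecs bools n) (λ S → 𝟙 (copy? A v (induced S)))
  ∑-𝟙-net A v = trans (∑-count _ (allCands n))
    (∑-𝟙-bijection _≟C_ _≟S_ (allCands n) (allVecs bools n) (allCands-enumerates n) (vertexSets-enumerate n)
      (λ c → (isSubgraph? G c ×-dec isInduced? G c) ×-dec copy? A v c) (λ S → copy? A v (induced S))
      vertices induced
      (λ c ((c⊆G , c-ind) , cp) → subst (Copy A v) (sym (induced-vertices c c⊆G c-ind)) cp)
      (λ S cp → (induced-subgraph S , induced-induced S) , cp)
      (λ c ((c⊆G , c-ind) , _) → induced-vertices c c⊆G c-ind)
      (λ S _ → vertices-induced S))

module _ {s k} (F : GraphletFamily s k) where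

  sumℤ-type : ∀ {n} (v : Fin n) (d : Cand n) (j : Fin k) → Copy (rep F j) v d → (t : Fin k → ℤ) →
              sumℤ (λ l → 𝟙 (copy? (rep F l) v d) * t l) ≡ t j
  sumℤ-type v d j cp t = trans
    (sumℤ-cong (λ l → cong (_* t l) (𝟙-cong (λ cp′ → copy-type-unique F v d l j cp′ cp) (λ { refl → cp })
                                             (copy? (rep F l) v d) (l ≟F j))))
    (sumℤ-select j t)

  sumℤ-untyped : ∀ {n} (v : Fin n) (d : Cand n) → ¬ (∃ λ l → Copy (rep F l) v d) → (t : Fin k → ℤ) →
                 sumℤ (λ l → 𝟙 (copy? (rep F l) v d) * t l) ≡ 0ℤ
  sumℤ-untyped v d untyped t =
    sumℤ-zero _ (λ l → cong (_* t l) (𝟙-no (copy? (rep F l) v d) (λ cp → untyped (l , cp))))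

  module _ {n} (G : Graph n) (v : Fin n) (i : Fin k) where
    open InducedSubgraph G

    ∑-copies-on-vertexSet : ∀ S →
      ∑ (allCands n) (λ c → 𝟙 (S ≟S vertices c) * 𝟙 (isSubgraph? G c ×-dec copy? (rep F i) v c))
      ≡ sumℤ (λ j → 𝟙 (copy? (rep F j) v (induced S)) * + U F i j)
    ∑-copies-on-vertexSet S = trans
      (∑-cong (allCands n) (λ c → trans (sym (𝟙-× (S ≟S vertices c) (isSubgraph? G c ×-dec copy? (rep F i) v c)))
                                        (𝟙-cong (to {c}) (from {c}) _ (spanningCopy? G (induced S) (rep F i) v c))))
      (by-type (any? (λ j → copy? (rep F j) v (induced S))))
      where
      to : ∀ {c} → (S ≡ vertices c) × IsSubgraph G c × Copy (rep F i) v c → SpanningCopy G (induced S) (rep F i) v c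
      to {c} (refl , c⊆G , cp) = c⊆G , cp , sym (vertices-induced (vertices c)) , c⊆induced
        where
        c⊆induced : c ⊆ᴱ induced (vertices c)
        c⊆induced x y e with proj₂ c⊆G x y e
        ... | Gxy , x∈c , y∈c rewrite inE-induced (vertices c) x y | x∈c | y∈c | Gxy = refl
      from : ∀ {c} → SpanningCopy G (induced S) (rep F i) v c → (S ≡ vertices c) × IsSubgraph G c × Copy (rep F i) v c
      from (c⊆G , cp , c≈S , _) = trans (sym (vertices-induced S)) (sym c≈S) , c⊆G , cp
      by-type : Dec (∃ λ j → Copy (rep F j) v (induced S)) →
                ∑ (allCands n) (λ c → 𝟙 (spanningCopy? G (induced S) (rep F i) v c))
                ≡ sumℤ (λ j → 𝟙 (copy? (rep F j) v (induced S)) * + U F i j)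
      by-type (yes (j , cp)) =
        trans (SpanningCopies.spanning-copies-count G (induced S) (induced-subgraph S) (rep F j) v cp (rep F i))
              (sym (sumℤ-type v (induced S) j cp (λ j → + U F i j)))
      by-type (no untyped) =
        trans (∑-zero (allCands n) _ (λ c → 𝟙-no (spanningCopy? G (induced S) (rep F i) v c)
                (λ (c⊆G , cp , c≈S , c⊆S) → untyped (spanning-supergraph-has-type F G v (rep F i) c (induced S)
                                                       (connected F i) cp (induced-subgraph S) c≈S c⊆S))))
              (sym (sumℤ-untyped v (induced S) untyped (λ j → + U F i j)))

    U·net≡gross : sumℕ (λ j → U F i j ℕ.* net (rep F j) G v) ≡ gross (rep F i) G v
    U·net≡gross = ℤ.+-injective (begin
      + sumℕ (λ j → U F i j ℕ.* net (rep F j) G v)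
        ≡⟨ +-sumℕ (λ j → U F i j ℕ.* net (rep F j) G v) ⟩
      sumℤ (λ j → + (U F i j ℕ.* net (rep F j) G v))
        ≡⟨ sumℤ-cong (λ j → trans (ℤ.pos-* (U F i j) _) (cong (+ U F i j *_) (∑-𝟙-net (rep F j) v))) ⟩
      sumℤ (λ j → + U F i j * ∑ Ss (λ S → 𝟙 (copy? (rep F j) v (induced S))))
        ≡⟨ sumℤ-cong (λ j → trans (sym (∑-*ˡ Ss (+ U F i j) _)) (∑-cong Ss (λ S → ℤ.*-comm (+ U F i j) _))) ⟩
      sumℤ (λ j → ∑ Ss (λ S → 𝟙 (copy? (rep F j) v (induced S)) * + U F i j))
        ≡⟨ sym (∑-sumℤ Ss (λ S j → 𝟙 (copy? (rep F j) v (induced S)) * + U F i j)) ⟩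
      ∑ Ss (λ S → sumℤ (λ j → 𝟙 (copy? (rep F j) v (induced S)) * + U F i j))
        ≡⟨ sym (∑-cong Ss ∑-copies-on-vertexSet) ⟩
      ∑ Ss (λ S → ∑ (allCands n) (λ c → 𝟙 (S ≟S vertices c) * 𝟙 (isSubgraph? G c ×-dec copy? (rep F i) v c)))
        ≡⟨ sym (∑-fibres _≟S_ Ss (vertexSets-enumerate n) (allCands n) vertices _) ⟩
      ∑ (allCands n) (λ c → 𝟙 (isSubgraph? G c ×-dec copy? (rep F i) v c))
        ≡⟨ sym (∑-𝟙-gross (rep F i) G v) ⟩
      + gross (rep F i) G v ∎)
      where
      open ≡-Reasoning
      Ss : List (Vec Bool n)
      Ss = allVecs bools n

sgn : ∀ {s k} → GraphletFamily s k → Fin k → ℤ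
sgn F l = sign (edges (graph (rep F l)))

module SignedInversion {s k} (F : GraphletFamily s k) {n} (G : Graph n) (v : Fin n) (i : Fin k) where

  C : List (Cand n)
  C = allCands n

  spanningCopies : Cand n → ℤ
  spanningCopies d = ∑ C (λ c → 𝟙 (spanningCopy? G d (rep F i) v c))

  weight : Cand n → ℤ
  weight d = 𝟙 (isSubgraph? G d) * σ d * spanningCopies d

  expand-gross : ∀ l → + U F i l * (sgn F l * + gross (rep F l) G v)
               ≡ ∑ C (λ d → 𝟙 (isSubgraph? G d) * 𝟙 (copy? (rep F l) v d) * (sgn F l * + U F i l))
  expand-gross l = begin
    + U F i l * (sgn F l * + gross (rep F l) G v)
      ≡⟨ cong (λ z → + U F i l * (sgn F l * z)) (∑-𝟙-gross (rep F l) G v) ⟩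
    + U F i l * (sgn F l * ∑ C (λ d → 𝟙 (isSubgraph? G d ×-dec copy? (rep F l) v d)))
      ≡⟨ rearrange (+ U F i l) (sgn F l) _ ⟩
    (sgn F l * + U F i l) * ∑ C (λ d → 𝟙 (isSubgraph? G d ×-dec copy? (rep F l) v d))
      ≡⟨ sym (∑-*ˡ C (sgn F l * + U F i l) _) ⟩
    ∑ C (λ d → (sgn F l * + U F i l) * 𝟙 (isSubgraph? G d ×-dec copy? (rep F l) v d))
      ≡⟨ ∑-cong C (λ d → trans (ℤ.*-comm (sgn F l * + U F i l) _)
                               (cong (_* (sgn F l * + U F i l)) (𝟙-× (isSubgraph? G d) (copy? (rep F l) v d)))) ⟩
    ∑ C (λ d → 𝟙 (isSubgraph? G d) * 𝟙 (copy? (rep F l) v d) * (sgn F l * + U F i l)) ∎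
    where
    open ≡-Reasoning
    rearrange : ∀ a b c → a * (b * c) ≡ (b * a) * c
    rearrange = solve-∀

  -- On a copy d of H_l, λ_l is the sign of d and U(i,l) counts the spanning copies of H_i in d.
  weight-of-type : ∀ d l → 𝟙 (isSubgraph? G d) * 𝟙 (copy? (rep F l) v d) * (sgn F l * + U F i l)
                         ≡ 𝟙 (copy? (rep F l) v d) * weight d
  weight-of-type d l with isSubgraph? G d | copy? (rep F l) v d
  ... | yes d⊆G | yes cp =
    trans (cong₂ (λ a b → 1ℤ * 1ℤ * (a * b)) sgn≡σ U≡spanningCopies) (units (σ d) (spanningCopies d))
    where
    sgn≡σ : sgn F l ≡ σ d
    sgn≡σ = sym (σ-copy G (rep F l) v d cp d⊆G)
    U≡spanningCopies : + U F i l ≡ spanningCopies d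
    U≡spanningCopies = sym (SpanningCopies.spanning-copies-count G d d⊆G (rep F l) v cp (rep F i))
    units : ∀ a b → 1ℤ * 1ℤ * (a * b) ≡ 1ℤ * (1ℤ * a * b)
    units = solve-∀
  ... | yes _ | no _   = vanish (sgn F l * + U F i l) (σ d) (spanningCopies d)
    where
    vanish : ∀ a b c → 1ℤ * 0ℤ * a ≡ 0ℤ * (1ℤ * b * c)
    vanish = solve-∀
  ... | no _  | cp?    = vanish (𝟙 cp?) (sgn F l * + U F i l) (σ d) (spanningCopies d)
    where
    vanish : ∀ a b c e → 0ℤ * a * b ≡ a * (0ℤ * c * e)
    vanish = solve-∀

  weight-untyped : ∀ d → ¬ (∃ λ l → Copy (rep F l) v d) → weight d ≡ 0ℤ
  weight-untyped d untyped with isSubgraph? G d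
  ... | no _    = trans (cong (_* spanningCopies d) (ℤ.*-zeroˡ (σ d))) (ℤ.*-zeroˡ (spanningCopies d))
  ... | yes d⊆G = trans (cong (1ℤ * σ d *_) no-spanning-copies) (ℤ.*-zeroʳ (1ℤ * σ d))
    where
    no-spanning-copies : spanningCopies d ≡ 0ℤ
    no-spanning-copies = ∑-zero C _ (λ c → 𝟙-no (spanningCopy? G d (rep F i) v c)
      (λ (c⊆G , cp , c≈d , c⊆d) → untyped (spanning-supergraph-has-type F G v (rep F i) c d (connected F i) cp d⊆G c≈d c⊆d)))

  sumℤ-weight : ∀ d → sumℤ (λ l → 𝟙 (copy? (rep F l) v d) * weight d) ≡ weight d
  sumℤ-weight d with any? (λ l → copy? (rep F l) v d)
  ... | yes (j , cp) = sumℤ-type F v d j cp (λ _ → weight d)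
  ... | no untyped   = trans (sumℤ-untyped F v d untyped (λ _ → weight d)) (sym (weight-untyped d untyped))

  indicator-swap : ∀ c d → 𝟙 (isSubgraph? G d) * σ d * 𝟙 (spanningCopy? G d (rep F i) v c)
                 ≡ 𝟙 (isSubgraph? G c ×-dec copy? (rep F i) v c) * (𝟙 (spanningSupergraph? G c d) * σ d)
  indicator-swap c d = begin
    𝟙 (isSubgraph? G d) * σ d * 𝟙 (spanningCopy? G d (rep F i) v c)
      ≡⟨ rearrange (𝟙 (isSubgraph? G d)) (σ d) (𝟙 (spanningCopy? G d (rep F i) v c)) ⟩
    𝟙 (isSubgraph? G d) * 𝟙 (spanningCopy? G d (rep F i) v c) * σ d
      ≡⟨ cong (_* σ d) (sym (𝟙-× (isSubgraph? G d) (spanningCopy? G d (rep F i) v c))) ⟩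
    𝟙 (isSubgraph? G d ×-dec spanningCopy? G d (rep F i) v c) * σ d
      ≡⟨ cong (_* σ d) (𝟙-cong to from (isSubgraph? G d ×-dec spanningCopy? G d (rep F i) v c)
                                       (SC? ×-dec spanningSupergraph? G c d)) ⟩
    𝟙 (SC? ×-dec spanningSupergraph? G c d) * σ d
      ≡⟨ cong (_* σ d) (𝟙-× SC? (spanningSupergraph? G c d)) ⟩
    𝟙 SC? * 𝟙 (spanningSupergraph? G c d) * σ d
      ≡⟨ ℤ.*-assoc (𝟙 SC?) _ _ ⟩
    𝟙 SC? * (𝟙 (spanningSupergraph? G c d) * σ d) ∎
    where
    open ≡-Reasoning
    SC? : Dec (IsSubgraph G c × Copy (rep F i) v c)
    SC? = isSubgraph? G c ×-dec copy? (rep F i) v c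
    rearrange : ∀ a b c → a * b * c ≡ a * c * b
    rearrange = solve-∀
    to : IsSubgraph G d × SpanningCopy G d (rep F i) v c → (IsSubgraph G c × Copy (rep F i) v c) × SpanningSupergraph G c d
    to (d⊆G , c⊆G , cp , c≈d , c⊆d) = (c⊆G , cp) , d⊆G , sym c≈d , c⊆d
    from : (IsSubgraph G c × Copy (rep F i) v c) × SpanningSupergraph G c d → IsSubgraph G d × SpanningCopy G d (rep F i) v c
    from ((c⊆G , cp) , d⊆G , d≈c , c⊆d) = d⊆G , c⊆G , cp , sym d≈c , c⊆d

  inner-sum : ∀ c → 𝟙 (isSubgraph? G c ×-dec copy? (rep F i) v c) * ∑ C (λ d → 𝟙 (spanningSupergraph? G c d) * σ d)
            ≡ sgn F i * 𝟙 ((isSubgraph? G c ×-dec isInduced? G c) ×-dec copy? (rep F i) v c)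
  inner-sum c = begin
    𝟙 SC? * ∑ C (λ d → 𝟙 (spanningSupergraph? G c d) * σ d)
      ≡⟨ 𝟙-*-cong SC? (λ (c⊆G , _) → ∑-σ-spanningSupergraphs G c c⊆G) ⟩
    𝟙 SC? * (𝟙 (isInduced? G c) * σ c)
      ≡⟨ 𝟙-*-cong SC? (λ (c⊆G , cp) → cong (𝟙 (isInduced? G c) *_) (σ-copy G (rep F i) v c cp c⊆G)) ⟩
    𝟙 SC? * (𝟙 (isInduced? G c) * sgn F i)
      ≡⟨ cong (_* (𝟙 (isInduced? G c) * sgn F i)) (𝟙-× (isSubgraph? G c) (copy? (rep F i) v c)) ⟩
    𝟙 (isSubgraph? G c) * 𝟙 (copy? (rep F i) v c) * (𝟙 (isInduced? G c) * sgn F i)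
      ≡⟨ rearrange (𝟙 (isSubgraph? G c)) (𝟙 (copy? (rep F i) v c)) (𝟙 (isInduced? G c)) (sgn F i) ⟩
    sgn F i * (𝟙 (isSubgraph? G c) * 𝟙 (isInduced? G c) * 𝟙 (copy? (rep F i) v c))
      ≡⟨ cong (λ z → sgn F i * (z * 𝟙 (copy? (rep F i) v c))) (sym (𝟙-× (isSubgraph? G c) (isInduced? G c))) ⟩
    sgn F i * (𝟙 (isSubgraph? G c ×-dec isInduced? G c) * 𝟙 (copy? (rep F i) v c))
      ≡⟨ cong (sgn F i *_) (sym (𝟙-× (isSubgraph? G c ×-dec isInduced? G c) (copy? (rep F i) v c))) ⟩
    sgn F i * 𝟙 ((isSubgraph? G c ×-dec isInduced? G c) ×-dec copy? (rep F i) v c) ∎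
    where
    open ≡-Reasoning
    SC? : Dec (IsSubgraph G c × Copy (rep F i) v c)
    SC? = isSubgraph? G c ×-dec copy? (rep F i) v c
    rearrange : ∀ a b c e → a * b * (c * e) ≡ e * (a * c * b)
    rearrange = solve-∀

  ∑-U-sgn-gross≡∑-weight : sumℤ (λ l → + U F i l * (sgn F l * + gross (rep F l) G v)) ≡ ∑ C weight
  ∑-U-sgn-gross≡∑-weight = begin
    sumℤ (λ l → + U F i l * (sgn F l * + gross (rep F l) G v))
      ≡⟨ sumℤ-cong (λ l → trans (expand-gross l) (∑-cong C (λ d → weight-of-type d l))) ⟩
    sumℤ (λ l → ∑ C (λ d → 𝟙 (copy? (rep F l) v d) * weight d))
      ≡⟨ sym (∑-sumℤ C (λ d l → 𝟙 (copy? (rep F l) v d) * weight d)) ⟩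
    ∑ C (λ d → sumℤ (λ l → 𝟙 (copy? (rep F l) v d) * weight d))
      ≡⟨ ∑-cong C sumℤ-weight ⟩
    ∑ C weight ∎
    where open ≡-Reasoning

  ∑-weight≡sgn-net : ∑ C weight ≡ sgn F i * + net (rep F i) G v
  ∑-weight≡sgn-net = begin
    ∑ C weight
      ≡⟨ ∑-cong C (λ d → sym (∑-*ˡ C (𝟙 (isSubgraph? G d) * σ d) _)) ⟩
    ∑ C (λ d → ∑ C (λ c → 𝟙 (isSubgraph? G d) * σ d * 𝟙 (spanningCopy? G d (rep F i) v c)))
      ≡⟨ ∑-swap C C _ ⟩
    ∑ C (λ c → ∑ C (λ d → 𝟙 (isSubgraph? G d) * σ d * 𝟙 (spanningCopy? G d (rep F i) v c)))
      ≡⟨ ∑-cong C (λ c → trans (∑-cong C (indicator-swap c))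
                               (∑-*ˡ C (𝟙 (isSubgraph? G c ×-dec copy? (rep F i) v c))
                                       (λ d → 𝟙 (spanningSupergraph? G c d) * σ d))) ⟩
    ∑ C (λ c → 𝟙 (isSubgraph? G c ×-dec copy? (rep F i) v c) * ∑ C (λ d → 𝟙 (spanningSupergraph? G c d) * σ d))
      ≡⟨ ∑-cong C inner-sum ⟩
    ∑ C (λ c → sgn F i * 𝟙 ((isSubgraph? G c ×-dec isInduced? G c) ×-dec copy? (rep F i) v c))
      ≡⟨ ∑-*ˡ C (sgn F i) _ ⟩
    sgn F i * ∑ C (λ c → 𝟙 ((isSubgraph? G c ×-dec isInduced? G c) ×-dec copy? (rep F i) v c))
      ≡⟨ cong (sgn F i *_) (sym (∑-count _ C)) ⟩
    sgn F i * + net (rep F i) G v ∎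
    where open ≡-Reasoning

  U·sgn·gross≡sgn·net : sumℤ (λ l → + U F i l * (sgn F l * + gross (rep F l) G v)) ≡ sgn F i * + net (rep F i) G v
  U·sgn·gross≡sgn·net = trans ∑-U-sgn-gross≡∑-weight ∑-weight≡sgn-net

δ≡𝟙 : ∀ {k} (i j : Fin k) → δ i j ≡ 𝟙 (i ≟F j)
δ≡𝟙 i j with i ≟F j
... | yes _ = refl
... | no _  = refl

sign-squared : ∀ m → sign m * sign m ≡ 1ℤ
sign-squared zero    = refl
sign-squared (suc m) = trans (neg-squared (sign m)) (sign-squared m)
  where
  neg-squared : ∀ a → - a * - a ≡ a * a
  neg-squared = solve-∀

*-δ-cancel : ∀ {k} (a b : ℤ) (i j : Fin k) → (i ≡ j → a * b ≡ 1ℤ) → a * (b * δ i j) ≡ δ i j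
*-δ-cancel a b i j ab≡1 rewrite δ≡𝟙 i j with i ≟F j
... | yes i≡j = trans (cong (a *_) (ℤ.*-identityʳ b)) (ab≡1 i≡j)
... | no _    = trans (cong (a *_) (ℤ.*-zeroʳ b)) (ℤ.*-zeroʳ a)

whole : ∀ {s} → Graph s → Cand s
whole K = cand (λ _ → true) (adj K)

module _ {s} (K : Graph s) where

  inV-whole : ∀ x → inV (whole K) x ≡ true
  inV-whole = inV-cand (λ _ → true) (adj K)

  inE-whole : ∀ x y → inE (whole K) x y ≡ adj K x y
  inE-whole = inE-cand (λ _ → true) (adj K)

  whole-subgraph : IsSubgraph K (whole K)
  whole-subgraph = (λ x y → trans (inE-whole x y) (trans (adj-sym K x y) (sym (inE-whole y x))))
                 , (λ x y e → trans (sym (inE-whole x y)) e , inV-whole x , inV-whole y)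

  induced-copy-is-whole : ∀ (A : Rooted s) r c → IsInduced K c → Copy A r c → c ≡ whole K
  induced-copy-is-whole A r c c-ind cp = Cand-ext c (whole K)
    (λ x → trans (spanning x) (sym (inV-whole x)))
    (λ x y → trans (c-ind x y (spanning x) (spanning y)) (sym (inE-whole x y)))
    where
    spanning : ∀ y → inV c y ≡ true
    spanning = copy-spanning A r c cp

whole-copy : ∀ {s} (B : Rooted s) → Copy B (root B) (whole (graph B))
whole-copy B = copy-by B (root B) (whole (graph B)) (λ x → x) refl (λ _ _ eq → eq) (inV-whole (graph B))
                       (λ u _ → u , refl) (λ x y → sym (inE-whole (graph B) x y))

module _ {s k} (F : GraphletFamily s k) where

  open SignedInversion F using (U·sgn·gross≡sgn·net)

  net-in-representative : ∀ i j → + net (rep F i) (graph (rep F j)) (root (rep F j)) ≡ δ i j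
  net-in-representative i j = begin
    + net (rep F i) K r
      ≡⟨ ∑-count _ C ⟩
    ∑ C (λ c → 𝟙 ((isSubgraph? K c ×-dec isInduced? K c) ×-dec copy? (rep F i) r c))
      ≡⟨ ∑-cong C (λ c → trans (𝟙-cong to from _ (c ≟C whole K ×-dec copy? (rep F i) r (whole K)))
                               (𝟙-× (c ≟C whole K) (copy? (rep F i) r (whole K)))) ⟩
    ∑ C (λ c → 𝟙 (c ≟C whole K) * 𝟙 (copy? (rep F i) r (whole K)))
      ≡⟨ ∑-select _≟C_ C (allCands-enumerates s) (whole K) _ ⟩
    𝟙 (copy? (rep F i) r (whole K))
      ≡⟨ 𝟙-cong (λ cp → copy-type-unique F r (whole K) i j cp (whole-copy (rep F j)))
                (λ { refl → whole-copy (rep F j) }) (copy? (rep F i) r (whole K)) (i ≟F j) ⟩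
    𝟙 (i ≟F j)
      ≡⟨ sym (δ≡𝟙 i j) ⟩
    δ i j ∎
    where
    open ≡-Reasoning
    K : Graph s
    K = graph (rep F j)
    r : Fin s
    r = root (rep F j)
    C : List (Cand s)
    C = allCands s
    to : ∀ {c} → (IsSubgraph K c × IsInduced K c) × Copy (rep F i) r c → (c ≡ whole K) × Copy (rep F i) r (whole K)
    to {c} ((_ , c-ind) , cp) = c≡K , subst (Copy (rep F i) r) c≡K cp
      where
      c≡K : c ≡ whole K
      c≡K = induced-copy-is-whole K (rep F i) r c c-ind cp
    from : ∀ {c} → (c ≡ whole K) × Copy (rep F i) r (whole K) → (IsSubgraph K c × IsInduced K c) × Copy (rep F i) r c
    from (refl , cp) = (whole-subgraph K , λ x y _ _ → inE-whole K x y) , cp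

  U·sgn·U≡sgn·δ : ∀ i j → sumℤ (λ l → Uℤ F i l * (sgn F l * Uℤ F l j)) ≡ sgn F i * δ i j
  U·sgn·U≡sgn·δ i j = trans (U·sgn·gross≡sgn·net (graph (rep F j)) (root (rep F j)) i)
                            (cong (sgn F i *_) (net-in-representative i j))

  Λ⊗ : ∀ (X : Fin k → Fin k → ℤ) i j → (Λ F ⊗ X) i j ≡ sgn F i * X i j
  Λ⊗ X i j = trans (sumℤ-cong diagonal) (sumℤ-select i (λ m → sgn F i * X m j))
    where
    rearrange : ∀ a b c → a * b * c ≡ b * (a * c)
    rearrange = solve-∀
    diagonal : ∀ m → sgn F i * δ i m * X m j ≡ 𝟙 (m ≟F i) * (sgn F i * X m j)
    diagonal m = trans (cong (λ z → sgn F i * z * X m j) (trans (δ≡𝟙 i m) (𝟙-cong sym sym (i ≟F m) (m ≟F i))))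
                       (rearrange (sgn F i) (𝟙 (m ≟F i)) (X m j))

  ⊗Λ : ∀ (X : Fin k → Fin k → ℤ) i j → (X ⊗ Λ F) i j ≡ X i j * sgn F j
  ⊗Λ X i j = trans (sumℤ-cong diagonal) (sumℤ-select j (λ m → X i m * sgn F m))
    where
    rearrange : ∀ a b c → a * (b * c) ≡ c * (a * b)
    rearrange = solve-∀
    diagonal : ∀ m → X i m * (sgn F m * δ m j) ≡ 𝟙 (m ≟F j) * (X i m * sgn F m)
    diagonal m = trans (cong (λ z → X i m * (sgn F m * z)) (δ≡𝟙 m j)) (rearrange (X i m) (sgn F m) (𝟙 (m ≟F j)))

  U⊗ΛUΛ≡δ : ∀ i j → (Uℤ F ⊗ (Λ F ⊗ (Uℤ F ⊗ Λ F))) i j ≡ δ i j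
  U⊗ΛUΛ≡δ i j = begin
    sumℤ (λ l → Uℤ F i l * (Λ F ⊗ (Uℤ F ⊗ Λ F)) l j)
      ≡⟨ sumℤ-cong (λ l → cong (Uℤ F i l *_) (trans (Λ⊗ (Uℤ F ⊗ Λ F) l j) (cong (sgn F l *_) (⊗Λ (Uℤ F) l j)))) ⟩
    sumℤ (λ l → Uℤ F i l * (sgn F l * (Uℤ F l j * sgn F j)))
      ≡⟨ sumℤ-cong (λ l → rearrange (Uℤ F i l) (sgn F l) (Uℤ F l j) (sgn F j)) ⟩
    sumℤ (λ l → sgn F j * (Uℤ F i l * (sgn F l * Uℤ F l j)))
      ≡⟨ sumℤ-*ˡ (sgn F j) (λ l → Uℤ F i l * (sgn F l * Uℤ F l j)) ⟩
    sgn F j * sumℤ (λ l → Uℤ F i l * (sgn F l * Uℤ F l j))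
      ≡⟨ cong (sgn F j *_) (U·sgn·U≡sgn·δ i j) ⟩
    sgn F j * (sgn F i * δ i j)
      ≡⟨ *-δ-cancel (sgn F j) (sgn F i) i j (λ { refl → sign-squared (edges (graph (rep F i))) }) ⟩
    δ i j ∎
    where
    open ≡-Reasoning
    rearrange : ∀ a b c e → a * (b * (c * e)) ≡ e * (a * (b * c))
    rearrange = solve-∀

  ΛUΛ⊗U≡δ : ∀ i j → ((Λ F ⊗ (Uℤ F ⊗ Λ F)) ⊗ Uℤ F) i j ≡ δ i j
  ΛUΛ⊗U≡δ i j = begin
    sumℤ (λ l → (Λ F ⊗ (Uℤ F ⊗ Λ F)) i l * Uℤ F l j)
      ≡⟨ sumℤ-cong (λ l → cong (_* Uℤ F l j) (trans (Λ⊗ (Uℤ F ⊗ Λ F) i l) (cong (sgn F i *_) (⊗Λ (Uℤ F) i l)))) ⟩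
    sumℤ (λ l → sgn F i * (Uℤ F i l * sgn F l) * Uℤ F l j)
      ≡⟨ sumℤ-cong (λ l → rearrange (sgn F i) (Uℤ F i l) (sgn F l) (Uℤ F l j)) ⟩
    sumℤ (λ l → sgn F i * (Uℤ F i l * (sgn F l * Uℤ F l j)))
      ≡⟨ sumℤ-*ˡ (sgn F i) (λ l → Uℤ F i l * (sgn F l * Uℤ F l j)) ⟩
    sgn F i * sumℤ (λ l → Uℤ F i l * (sgn F l * Uℤ F l j))
      ≡⟨ cong (sgn F i *_) (U·sgn·U≡sgn·δ i j) ⟩
    sgn F i * (sgn F i * δ i j)
      ≡⟨ *-δ-cancel (sgn F i) (sgn F i) i j (λ _ → sign-squared (edges (graph (rep F i)))) ⟩
    δ i j ∎
    where
    open ≡-Reasoning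
    rearrange : ∀ a b c e → a * (b * c) * e ≡ a * (b * (c * e))
    rearrange = solve-∀

theorem1 : (s k : ℕ) → 1 < s → (F : GraphletFamily s k) →
    ((n : ℕ) (G : Graph n) (v : Fin n) (i : Fin k) →
    sumℕ (λ j → U F i j ℕ.* net (rep F j) G v) ≡ gross (rep F i) G v)
    × ((i j : Fin k) →
    ((Uℤ F ⊗ (Λ F ⊗ (Uℤ F ⊗ Λ F))) i j ≡ δ i j)
    × (((Λ F ⊗ (Uℤ F ⊗ Λ F)) ⊗ Uℤ F) i j ≡ δ i j))
theorem1 s k _ F = (λ n G v i → U·net≡gross F G v i) , (λ i j → U⊗ΛUΛ≡δ F i j , ΛUΛ⊗U≡δ F i j)
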